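{- Let $M$ be a closed term. Then $M$ is almost surely terminating (i.e. $\mathcal{P}(M)=1$) if and only if $\sup\{\|\mathtt{a}\|\mid \text{there is a tight derivation of }\vdash^{w}M:\mathtt{a}\text{ for some }w\}=1$. Moreover, $M$ is positively almost surely terminating (i.e. $\mathcal{E}(M)<\infty$) if and only if $\sup\{w\mid \text{there is a tight derivation of }\vdash^{w}M:\mathtt{a}\text{ for some }\mathtt{a}\}<\infty$.
   Context: Terms: values $V ::= x \mid \lambda x.M$; terms $M ::= V \mid VV \mid M\oplus M \mid \mathtt{let}\ x = M\ \mathtt{in}\ M$; $M\{V/x\}$ is capture-avoiding substitution. A multidistribution on terms is a finite multiset $\langle p_iM_i\rangle_{i\in I}$ with $p_i\in(0,1]$, $\sum_ip_i\le1$; $\sqcup$ is multiset union and $q\cdot\langle p_iM_i\rangle=\langle (qp_i)M_i\rangle$. One-step reduction: $(\lambda x.M)V\to\langle 1\,M\{V/x\}\rangle$; $\mathtt{let}\ x=V\ \mathtt{in}\ M\to\langle 1\,M\{V/x\}\rangle$; $M\oplus N\to\langle\tfrac12 M,\tfrac12 N\rangle$; if $N\to\langle p_iN_i\rangle_{i\in I}$ then $\mathtt{let}\ x=N\ \mathtt{in}\ M\to\langle p_i(\mathtt{let}\ x=N_i\ \mathtt{in}\ M)\rangle_{i\in I}$. Lifting to multidistributions of closed terms: $\langle p_iM_i\rangle_{i\in I}\Rightarrow\bigsqcup_i p_i\cdot\mathbf{m}_i$ where $\mathbf{m}_i=\langle 1M_i\rangle$ if $M_i$ is a value and $M_i\to\mathbf{m}_i$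 otherwise. For closed $M$ let $\langle 1M\rangle=\mathbf{m}_0\Rightarrow\mathbf{m}_1\Rightarrow\cdots$; $\mathcal{P}_k(M)$ is the sum of the probabilities of the values occurring in $\mathbf{m}_k$; $\mathcal{P}(M)=\sup_k\mathcal{P}_k(M)$; $\mathcal{E}_k(M)=\sum_{j=0}^{k-1}(1-\mathcal{P}_j(M))$ and $\mathcal{E}(M)=\sup_k\mathcal{E}_k(M)$. Types: arrow types $\mathtt{A} ::= \mathcal{M}\to \mathtt{a}$; intersection types $\mathcal{M} ::= [q_1\cdot \mathtt{A}_1,\dots,q_n\cdot\mathtt{A}_n]$ ($n\ge0$, scale factors $q_i\in(0,1]\cap\mathbb{Q}$); type distributions $\mathtt{a} ::= \langle p_1\mathcal{M}_1,\dots,p_n\mathcal{M}_n\rangle$ ($n\ge0$, $p_i\in(0,1]$, $\sum p_i\le1$), with norm $\|\mathtt{a}\|=\sum_i p_i$; $\mathbf{0}$ is the empty type distribution. Scaling: $u\cdot[q_i\cdot\mathtt{A}_i]_i=[(uq_i)\cdot \mathtt{A}_i]_i$, $u\cdot\langle p_i\mathcal{M}_i\rangle_i=\langle (up_i)\mathcal{M}_i\rangle_i$; $\uplus,\sqcup$ multiset unions. Typing contexts map variables to intersection types (finitely many nonempty), pointwise $\uplus$ and scaling. Rules for $\Gamma\vdash^{w}M:\tau$ ($w\in\mathbb{Q}$): (Var) $x:\mathcal{M}\vdash^0 x:\mathcal{M}$. (Zero) $\vdash^0 M:\mathbf{0}$. (@) from $\Gamma\vdash^{w}V:[1\cdot(\mathcal{M}\to\mathtt{b})]$,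 $\Delta\vdash^{v}W:\mathcal{M}$ infer $\Gamma\uplus\Delta\vdash^{w+v}VW:\mathtt{b}$. ($\oplus$) from $\Gamma\vdash^{w}M:\mathtt{a}$, $\Delta\vdash^{v}N:\mathtt{b}$ infer $\tfrac12\cdot\Gamma\uplus\tfrac12\cdot\Delta\vdash^{\frac12 w+\frac12 v+1}M\oplus N:\tfrac12\mathtt{a}\sqcup\tfrac12\mathtt{b}$. ($\lambda$) from $\Gamma,x:\mathcal{M}\vdash^{w}M:\mathtt{b}$ infer $\Gamma\vdash^{w+1}\lambda x.M:\mathcal{M}\to\mathtt{b}$. (let) from $\Gamma\vdash^{v}N:\langle p_k\mathcal{M}_k\rangle_{k\in K}$ and $\Delta_k,x:\mathcal{M}_k\vdash^{w_k}M:\mathtt{b}_k$ ($k\in K$) infer $\Gamma\uplus_{k}p_k\cdot\Delta_k\vdash^{\sum_k p_kw_k+v+1}\mathtt{let}\ x=N\ \mathtt{in}\ M:\bigsqcup_k p_k\mathtt{b}_k$. (Val) from $\Gamma\vdash^{w}V:\mathcal{M}$ infer $\Gamma\vdash^{w}V:\langle 1\mathcal{M}\rangle$. (!) for finite possibly empty $I$, from $\Gamma_i\vdash^{w_i}V:\mathtt{A}_i$ and scale factors $q_i$ infer $\uplus_i q_i\cdot\Gamma_i\vdash^{\sum_i q_iw_i}V:[q_i\cdot\mathtt{A}_i]_{i\in I}$. A type distribution is tight if it has the form $\langle q_k[\,]\rangle_{k\in K}$ ($K$ possibly empty); a derivation of $\vdash^{w}M:\mathtt{a}$ (empty context) is tight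 if $\mathtt{a}$ is tight. -}

module Defs where

open import Data.Nat using (ℕ; zero; suc)
open import Data.Fin using (Fin; zero; suc)
open import Data.Bool using (Bool; true; false; if_then_else_)
open import Data.List using (List; []; _∷_; _++_; map; foldr; concatMap)
open import Data.List.Relation.Unary.All using (All)
open import Data.List.Relation.Binary.Permutation.Homogeneous using (Permutation)
open import Data.Vec using (Vec; replicate; zipWith; _[_]≔_) renaming (_∷_ to _∷v_; map to mapv)
open import Data.Product using (Σ; ∃; _×_; _,_; proj₁; proj₂; map₁)
open import Data.Unit using (⊤)
open import Data.Rational using (ℚ; 0ℚ; 1ℚ; ½; _+_; _*_; _-_; _≤_; _<_)
open import Relation.Binary.PropositionalEquality using (_≡_)

-- Terms (well-scoped de Bruijn syntax; Term 0 = closed terms)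

mutual
  data Val (n : ℕ) : Set where
    var : Fin n → Val n
    lam : Term (suc n) → Val n

  data Term (n : ℕ) : Set where
    val  : Val n → Term n
    app  : Val n → Val n → Term n
    _⊕_  : Term n → Term n → Term n
    let' : Term n → Term (suc n) → Term n   -- let x = N in M  (M binds x)

ext : ∀ {n m} → (Fin n → Fin m) → Fin (suc n) → Fin (suc m)
ext ρ zero    = zero
ext ρ (suc i) = suc (ρ i)

mutual
  renV : ∀ {n m} → (Fin n → Fin m) → Val n → Val m
  renV ρ (var i) = var (ρ i)
  renV ρ (lam M) = lam (renT (ext ρ) M)

  renT : ∀ {n m} → (Fin n → Fin m) → Term n → Term m
  renT ρ (val V)    = val (renV ρ V)
  renT ρ (app V W)  = app (renV ρ V) (renV ρ W)
  renT ρ (M ⊕ N)    = renT ρ M ⊕ renT ρ N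
  renT ρ (let' N M) = let' (renT ρ N) (renT (ext ρ) M)

exts : ∀ {n m} → (Fin n → Val m) → Fin (suc n) → Val (suc m)
exts σ zero    = var zero
exts σ (suc i) = renV suc (σ i)

mutual
  subV : ∀ {n m} → (Fin n → Val m) → Val n → Val m
  subV σ (var i) = σ i
  subV σ (lam M) = lam (subT (exts σ) M)

  subT : ∀ {n m} → (Fin n → Val m) → Term n → Term m
  subT σ (val V)    = val (subV σ V)
  subT σ (app V W)  = app (subV σ V) (subV σ W)
  subT σ (M ⊕ N)    = subT σ M ⊕ subT σ N
  subT σ (let' N M) = let' (subT σ N) (subT (exts σ) M)

-- M{V/x}, x being the outermost bound variable (index zero)
_[_/0] : ∀ {n} → Term (suc n) → Val n → Term n
M [ V /0] = subT σ M
  where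
  σ : _ → _
  σ zero    = V
  σ (suc i) = var i

MDist : Set
MDist = List (ℚ × Term 0)

scaleM : ℚ → MDist → MDist
scaleM q = map (map₁ (q *_))

-- For a closed term: the multidistribution m with M → m if M is not a
-- value, and ⟨1 M⟩ if M is a value (exactly the lifting convention).
stepT : Term 0 → MDist
stepT (val V)          = (1ℚ , val V) ∷ []
stepT (app (lam M) V)  = (1ℚ , M [ V /0]) ∷ []
stepT (app (var ()) W)
stepT (M ⊕ N)          = (½ , M) ∷ (½ , N) ∷ []
stepT (let' (val V) M) = (1ℚ , M [ V /0]) ∷ []
stepT (let' (app V W) M) = map (λ pN → proj₁ pN , let' (proj₂ pN) M) (stepT (app V W))
stepT (let' (N ⊕ N') M)  = map (λ pN → proj₁ pN , let' (proj₂ pN) M) (stepT (N ⊕ N'))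
stepT (let' (let' N K) M) = map (λ pN → proj₁ pN , let' (proj₂ pN) M) (stepT (let' N K))

-- the lifted relation ⇒ (a function, since it is deterministic)
liftStep : MDist → MDist
liftStep m = concatMap (λ pM → scaleM (proj₁ pM) (stepT (proj₂ pM))) m

iterM : Term 0 → ℕ → MDist
iterM M zero    = (1ℚ , M) ∷ []
iterM M (suc k) = liftStep (iterM M k)

isValue : ∀ {n} → Term n → Bool
isValue (val _) = true
isValue _       = false

valueMass : MDist → ℚ
valueMass = foldr (λ pM r → (if isValue (proj₂ pM) then proj₁ pM else 0ℚ) + r) 0ℚ

Pk : Term 0 → ℕ → ℚ
Pk M k = valueMass (iterM M k)

Ek : Term 0 → ℕ → ℚ
Ek M zero    = 0ℚ
Ek M (suc k) = Ek M k + (1ℚ - Pk M k)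

SupIsOne : (ℚ → Set) → Set
SupIsOne S = (∀ x → S x → x ≤ 1ℚ)
           × (∀ ε → 0ℚ < ε → ∃ λ x → S x × (1ℚ - ε) < x)

BoundedAbove : (ℚ → Set) → Set
BoundedAbove S = ∃ λ B → ∀ x → S x → x ≤ B

AST : Term 0 → Set
AST M = SupIsOne (λ x → ∃ λ k → x ≡ Pk M k)

PAST : Term 0 → Set
PAST M = BoundedAbove (λ x → ∃ λ k → x ≡ Ek M k)

mutual
  data Arrow : Set where
    _⇒_ : List (ℚ × Arrow) → List (ℚ × List (ℚ × Arrow)) → Arrow

Inter : Set
Inter = List (ℚ × Arrow)

TDist : Set
TDist = List (ℚ × Inter)

norm : TDist → ℚ
norm = foldr (λ pM r → proj₁ pM + r) 0ℚ

InUnit : ℚ → Set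
InUnit q = (0ℚ < q) × (q ≤ 1ℚ)

-- well-formedness: the side conditions of the type grammar
mutual
  WFArrow : Arrow → Set
  WFArrow (M ⇒ a) = WFInter M × WFDist a

  WFInter : Inter → Set
  WFInter []            = ⊤
  WFInter ((q , A) ∷ M) = InUnit q × WFArrow A × WFInter M

  WFDist' : TDist → Set
  WFDist' []            = ⊤
  WFDist' ((p , M) ∷ a) = InUnit p × WFInter M × WFDist' a

  WFDist : TDist → Set
  WFDist a = WFDist' a × (norm a ≤ 1ℚ)

-- multiset equality of types (deep: intersections and type distributions
-- are multisets, compared up to permutation at every level)
mutual
  data _≈A_ : Arrow → Arrow → Set where
    arr≈ : ∀ {M M' a a'} → M ≈I M' → a ≈D a' → (M ⇒ a) ≈A (M' ⇒ a')

  data _≈I_ : Inter → Inter → Set where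
    inter≈ : ∀ {M M'} →
      Permutation (λ x y → (proj₁ x ≡ proj₁ y) × (proj₂ x ≈A proj₂ y)) M M' →
      M ≈I M'

  data _≈D_ : TDist → TDist → Set where
    dist≈ : ∀ {a a'} →
      Permutation (λ x y → (proj₁ x ≡ proj₁ y) × (proj₂ x ≈I proj₂ y)) a a' →
      a ≈D a'

scaleI : ℚ → Inter → Inter
scaleI u = map (map₁ (u *_))

scaleD : ℚ → TDist → TDist
scaleD u = map (map₁ (u *_))

Tight : TDist → Set
Tight a = All (λ pM → proj₂ pM ≡ []) a

Ctx : ℕ → Set
Ctx n = Vec Inter n

∅ : ∀ {n} → Ctx n
∅ = replicate _ []

_⊎c_ : ∀ {n} → Ctx n → Ctx n → Ctx n
_⊎c_ = zipWith _++_

_·c_ : ∀ {n} → ℚ → Ctx n → Ctx n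
u ·c Γ = mapv (scaleI u) Γ

single : ∀ {n} → Fin n → Inter → Ctx n
single x M = ∅ [ x ]≔ M

mutual
  data DerA {n : ℕ} : Ctx n → ℚ → Val n → Arrow → Set where
    λ-rule : ∀ {Γ M w Mx b} →
      DerT (Mx ∷v Γ) w M b → DerA Γ (w + 1ℚ) (lam M) (Mx ⇒ b)

  data DerI {n : ℕ} : Ctx n → ℚ → Val n → Inter → Set where
    var-rule : ∀ {x M} → WFInter M → DerI (single x M) 0ℚ (var x) M
    !-rule   : ∀ {Γ w V M} → Bang Γ w V M → DerI Γ w V M

  -- the finite family of premises of rule (!)
  data Bang {n : ℕ} : Ctx n → ℚ → Val n → Inter → Set where
    bang-nil  : ∀ {V} → Bang ∅ 0ℚ V []
    bang-cons : ∀ {Γ Δ w v V A M q} → InUnit q →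
      DerA Γ w V A → Bang Δ v V M →
      Bang ((q ·c Γ) ⊎c Δ) ((q * w) + v) V ((q , A) ∷ M)

  data DerT {n : ℕ} : Ctx n → ℚ → Term n → TDist → Set where
    zero-rule : ∀ {M} → DerT ∅ 0ℚ M []
    app-rule  : ∀ {Γ Δ w v V W M M' b} →
      DerI Γ w V ((1ℚ , (M ⇒ b)) ∷ []) → DerI Δ v W M' → M' ≈I M →
      DerT (Γ ⊎c Δ) (w + v) (app V W) b
    ⊕-rule    : ∀ {Γ Δ w v M N a b} →
      DerT Γ w M a → DerT Δ v N b →
      DerT ((½ ·c Γ) ⊎c (½ ·c Δ)) (((½ * w) + (½ * v)) + 1ℚ) (M ⊕ N)
           (scaleD ½ a ++ scaleD ½ b)
    let-rule  : ∀ {Γ Δ v ws N M a b} →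
      DerT Γ v N a → Branches M a Δ ws b →
      DerT (Γ ⊎c Δ) ((ws + v) + 1ℚ) (let' N M) b
    val-rule  : ∀ {Γ w V M} → DerI Γ w V M → DerT Γ w (val V) ((1ℚ , M) ∷ [])

  -- the family of premises Δ_k , x : M_k ⊢^{w_k} M : b_k of rule (let),
  -- one per element (p_k , M_k) of the type distribution of N; produces
  -- ⊎_k p_k·Δ_k,  Σ_k p_k w_k  and  ⊔_k p_k b_k
  data Branches {n : ℕ} (M : Term (suc n)) : TDist → Ctx n → ℚ → TDist → Set where
    br-nil  : Branches M [] ∅ 0ℚ []
    br-cons : ∀ {p Mk Mx Δ Δs w ws b bs a} →
      DerT (Mx ∷v Δ) w M b → Mx ≈I Mk → Branches M a Δs ws bs →
      Branches M ((p , Mk) ∷ a) ((p ·c Δ) ⊎c Δs) ((p * w) + ws) (scaleD p b ++ bs)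

TightNorms : Term 0 → ℚ → Set
TightNorms M x = ∃ λ w → ∃ λ a → Tight a × DerT ∅ w M a × (x ≡ norm a)

TightWeights : Term 0 → ℚ → Set
TightWeights M w = ∃ λ a → Tight a × DerT ∅ w M a

-- A tight derivation of ⊢ʷ M : a is a quantitative certificate of reduction:
-- along the lifted reduction, the weight w counts expected reduction steps and
-- ‖a‖ the probability of reaching a value.
-- Subject reduction (whose key case is a substitution lemma for values typed
-- by rule (!)) turns a derivation of a non-value of weight w into derivations
-- of its one-step reducts of total weight w - 1, each of smaller size.
-- Iterating it as many times as the size of the derivation leaves only values
-- and the empty derivation, so w ≤ E_K(M) and ‖a‖ ≤ P_K(M) for some K.
-- Conversely, subject expansion (via anti-substitution) pulls the trivial
-- tight typing of the values reached after k steps back to a tight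
-- derivation of M with ‖a‖ = P_k(M) and w ≥ E_k(M). Thus in each equivalence
-- every element of either set is dominated by an element of the other, and
-- the two suprema agree.

module Submission where

open import Data.Bool using (Bool; true; false; if_then_else_)
open import Data.Fin using (Fin; zero; suc; _↑ˡ_)
open import Data.Integer using (+<+; +≤+)
open import Data.List using (List; []; _∷_; _++_; map)
open import Data.List.Properties using (++-identityʳ; ++-assoc; map-++)
open import Data.List.Relation.Binary.Permutation.Homogeneous using (Permutation; prep; swap) renaming (refl to prefl; trans to ptrans)
open import Data.List.Relation.Binary.Permutation.Propositional using (_↭_; ↭-sym) renaming (refl to ↭refl; prep to ↭prep; swap to ↭swap; trans to ↭trans)
open import Data.List.Relation.Binary.Permutation.Propositional.Properties using (↭-singleton-inv; shifts; ++⁺ˡ) renaming (++⁺ to ↭-++⁺)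
open import Data.List.Relation.Binary.Pointwise using (Pointwise; []; _∷_)
import Data.List.Relation.Binary.Pointwise as Pw
open import Data.List.Relation.Unary.All using (All; []; _∷_)
import Data.List.Relation.Unary.All.Properties as AllP
open import Data.Nat as N using (ℕ; zero; suc; s≤s; z≤n; _∸_)
import Data.Nat.Properties as NP
import Algebra.Properties.CommutativeSemigroup NP.+-commutativeSemigroup as ℕ+
open import Data.Product using (Σ; ∃; _×_; _,_; proj₁; proj₂; map₁)
open import Data.Rational using (ℚ; 0ℚ; 1ℚ; ½; _+_; _*_; _-_; _≤_; _<_; *<*; *≤*; positive; nonNegative)
open import Data.Rational.Properties using (*-zeroʳ; +-identityˡ; +-identityʳ; *-assoc; +-assoc; *-identityˡ; *-identityʳ; ≤-refl; ≤-trans; ≤-reflexive; +-mono-≤; +-monoˡ-≤; +-monoʳ-≤; *-distribˡ-+; <⇒≤; <-≤-trans; *-monoˡ-≤-nonNeg; pos*pos⇒pos; nonNeg*nonNeg⇒nonNeg; positive⁻¹; nonNegative⁻¹)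
open import Data.Rational.Solver
open import Data.Unit using (⊤; tt)
open import Data.Vec using (Vec) renaming (_∷_ to _∷v_; [] to []v; _++_ to _++v_)
open import Function.Bundles using (_⇔_; mk⇔)
open import Relation.Binary.PropositionalEquality
open +-*-Solver using (solve; _:=_; _:+_; _:*_; _:-_; con)

open import Defs

*-monoˡ-≤-nonneg : ∀ {r p q} → 0ℚ ≤ r → p ≤ q → r * p ≤ r * q
*-monoˡ-≤-nonneg {r} h p≤q = *-monoˡ-≤-nonNeg r {{nonNegative h}} p≤q

*-pos : ∀ {p q} → 0ℚ < p → 0ℚ < q → 0ℚ < p * q
*-pos {p} {q} h1 h2 = positive⁻¹ (p * q) {{pos*pos⇒pos p {{positive h1}} q {{positive h2}}}}

*-nonneg : ∀ {p q} → 0ℚ ≤ p → 0ℚ ≤ q → 0ℚ ≤ p * q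
*-nonneg {p} {q} h1 h2 = nonNegative⁻¹ (p * q) {{nonNeg*nonNeg⇒nonNeg p {{nonNegative h1}} q {{nonNegative h2}}}}

InUnit-* : ∀ {u q} → InUnit u → InUnit q → InUnit (u * q)
InUnit-* {u} {q} (a , b) (c , d) = *-pos a c ,
  ≤-trans (*-monoˡ-≤-nonneg (<⇒≤ a) d) (≤-trans (≤-reflexive (*-identityʳ u)) b)

InUnit-½ : InUnit ½
InUnit-½ = *<* (+<+ (s≤s z≤n)) , *≤* (+≤+ (s≤s z≤n))

InUnit-1 : InUnit 1ℚ
InUnit-1 = *<* (+<+ (s≤s z≤n)) , ≤-refl

0≤1 : 0ℚ ≤ 1ℚ
0≤1 = <⇒≤ (proj₁ InUnit-1)

≤-+-interchange : ∀ a b s1 s2 {a' b' s} → a' N.≤ a N.+ s1 → b' N.≤ b N.+ s2 → s ≡ s1 N.+ s2 →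
  a' N.+ b' N.≤ (a N.+ b) N.+ s
≤-+-interchange a b s1 s2 {a'} {b'} {s} h1 h2 refl =
  NP.≤-trans (NP.+-mono-≤ h1 h2)
    (NP.≤-reflexive (ℕ+.interchange a s1 b s2))

ext-comp : ∀ {n m k} {f : Fin m → Fin k} {g : Fin n → Fin m} {h : Fin n → Fin k} →
  (∀ i → f (g i) ≡ h i) → ∀ i → ext f (ext g i) ≡ ext h i
ext-comp e zero = refl
ext-comp e (suc i) = cong suc (e i)

mutual
  renV-comp : ∀ {n m k} {f : Fin m → Fin k} {g : Fin n → Fin m} {h : Fin n → Fin k} →
    (∀ i → f (g i) ≡ h i) → ∀ V → renV f (renV g V) ≡ renV h V
  renV-comp e (var i) = cong var (e i)
  renV-comp e (lam M) = cong lam (renT-comp (ext-comp e) M)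

  renT-comp : ∀ {n m k} {f : Fin m → Fin k} {g : Fin n → Fin m} {h : Fin n → Fin k} →
    (∀ i → f (g i) ≡ h i) → ∀ M → renT f (renT g M) ≡ renT h M
  renT-comp e (val V) = cong val (renV-comp e V)
  renT-comp e (app V W) = cong₂ app (renV-comp e V) (renV-comp e W)
  renT-comp e (M ⊕ N) = cong₂ _⊕_ (renT-comp e M) (renT-comp e N)
  renT-comp e (let' N M) = cong₂ let' (renT-comp e N) (renT-comp (ext-comp e) M)

ext-id : ∀ {n} {f : Fin n → Fin n} → (∀ i → f i ≡ i) → ∀ i → ext f i ≡ i
ext-id e zero = refl
ext-id e (suc i) = cong suc (e i)

mutual
  renV-id : ∀ {n} {f : Fin n → Fin n} → (∀ i → f i ≡ i) → ∀ V → renV f V ≡ V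
  renV-id e (var i) = cong var (e i)
  renV-id e (lam M) = cong lam (renT-id (ext-id e) M)

  renT-id : ∀ {n} {f : Fin n → Fin n} → (∀ i → f i ≡ i) → ∀ M → renT f M ≡ M
  renT-id e (val V) = cong val (renV-id e V)
  renT-id e (app V W) = cong₂ app (renV-id e V) (renV-id e W)
  renT-id e (M ⊕ N) = cong₂ _⊕_ (renT-id e M) (renT-id e N)
  renT-id e (let' N M) = cong₂ let' (renT-id e N) (renT-id (ext-id e) M)

exts-cong : ∀ {n m} {σ τ : Fin n → Val m} → (∀ i → σ i ≡ τ i) → ∀ i → exts σ i ≡ exts τ i
exts-cong e zero = refl
exts-cong e (suc i) = cong (renV suc) (e i)

mutual
  subV-cong : ∀ {n m} {σ τ : Fin n → Val m} → (∀ i → σ i ≡ τ i) → ∀ V → subV σ V ≡ subV τ V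
  subV-cong e (var i) = e i
  subV-cong e (lam M) = cong lam (subT-cong (exts-cong e) M)

  subT-cong : ∀ {n m} {σ τ : Fin n → Val m} → (∀ i → σ i ≡ τ i) → ∀ M → subT σ M ≡ subT τ M
  subT-cong e (val V) = cong val (subV-cong e V)
  subT-cong e (app V W) = cong₂ app (subV-cong e V) (subV-cong e W)
  subT-cong e (M ⊕ N) = cong₂ _⊕_ (subT-cong e M) (subT-cong e N)
  subT-cong e (let' N M) = cong₂ let' (subT-cong e N) (subT-cong (exts-cong e) M)

topSubst : Val 0 → Fin 1 → Val 0
topSubst V zero = V

subT-topSubst : ∀ (M : Term 1) V → subT (topSubst V) M ≡ M [ V /0]
subT-topSubst M V = subT-cong (λ { zero → refl }) M

lastVar : ∀ d → Fin (d N.+ 1)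
lastVar zero = zero
lastVar (suc d) = suc (lastVar d)

data LastVarView (d : ℕ) : Fin (d N.+ 1) → Set where
  inner : (j : Fin d) → LastVarView d (j ↑ˡ 1)
  last : LastVarView d (lastVar d)

lastVarView : ∀ d (i : Fin (d N.+ 1)) → LastVarView d i
lastVarView zero zero = last
lastVarView (suc d) zero = inner zero
lastVarView (suc d) (suc i) with lastVarView d i
... | inner j = inner (suc j)
... | last = last

noVars : ∀ {d} → Fin 0 → Fin d
noVars ()

weakenClosed : ∀ d → Val 0 → Val d
weakenClosed d V = renV (noVars {d}) V

record SubstLast (V0 : Val 0) (d : ℕ) (σ : Fin (d N.+ 1) → Val d) : Set where
  field
    substLast-inner  : ∀ j → σ (j ↑ˡ 1) ≡ var j
    substLast-last : σ (lastVar d) ≡ weakenClosed d V0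
open SubstLast public

substLast-exts : ∀ {V0 d σ} → SubstLast V0 d σ → SubstLast V0 (suc d) (exts σ)
substLast-inner (substLast-exts s) zero = refl
substLast-inner (substLast-exts s) (suc j) = cong (renV suc) (substLast-inner s j)
substLast-last (substLast-exts {V0} {d} s) =
  trans (cong (renV suc) (substLast-last s)) (renV-comp (λ ()) V0)

substLast-top : ∀ {V0} {σ : Fin 1 → Val 0} → σ zero ≡ V0 → SubstLast V0 0 σ
substLast-inner (substLast-top e) ()
substLast-last (substLast-top {V0} e) = trans e (sym (renV-id (λ ()) V0))

initC : ∀ {A : Set} d → Vec A (d N.+ 1) → Vec A d
initC zero (x ∷v []v) = []v
initC (suc d) (x ∷v xs) = x ∷v initC d xs

lastC : ∀ {A : Set} d → Vec A (d N.+ 1) → A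
lastC zero (x ∷v []v) = x
lastC (suc d) (x ∷v xs) = lastC d xs

initC-⊎ : ∀ d (Γ Δ : Ctx (d N.+ 1)) → initC d (Γ ⊎c Δ) ≡ initC d Γ ⊎c initC d Δ
initC-⊎ zero (x ∷v []v) (y ∷v []v) = refl
initC-⊎ (suc d) (x ∷v xs) (y ∷v ys) = cong (_ ∷v_) (initC-⊎ d xs ys)

lastC-⊎ : ∀ d (Γ Δ : Ctx (d N.+ 1)) → lastC d (Γ ⊎c Δ) ≡ lastC d Γ ++ lastC d Δ
lastC-⊎ zero (x ∷v []v) (y ∷v []v) = refl
lastC-⊎ (suc d) (x ∷v xs) (y ∷v ys) = lastC-⊎ d xs ys

initC-· : ∀ d u (Γ : Ctx (d N.+ 1)) → initC d (u ·c Γ) ≡ u ·c initC d Γ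
initC-· zero u (x ∷v []v) = refl
initC-· (suc d) u (x ∷v xs) = cong (_ ∷v_) (initC-· d u xs)

lastC-· : ∀ d u (Γ : Ctx (d N.+ 1)) → lastC d (u ·c Γ) ≡ scaleI u (lastC d Γ)
lastC-· zero u (x ∷v []v) = refl
lastC-· (suc d) u (x ∷v xs) = lastC-· d u xs

initC-∅ : ∀ d → initC d (∅ {d N.+ 1}) ≡ ∅
initC-∅ zero = refl
initC-∅ (suc d) = cong ([] ∷v_) (initC-∅ d)

lastC-∅ : ∀ d → lastC d (∅ {d N.+ 1}) ≡ []
lastC-∅ zero = refl
lastC-∅ (suc d) = lastC-∅ d

initC-inj : ∀ d (j : Fin d) M → initC d (single (j ↑ˡ 1) M) ≡ single j M
initC-inj (suc d) zero M = cong (M ∷v_) (initC-∅ d)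
initC-inj (suc d) (suc j) M = cong ([] ∷v_) (initC-inj d j M)

lastC-inj : ∀ d (j : Fin d) M → lastC d (single (j ↑ˡ 1) M) ≡ []
lastC-inj (suc d) zero M = lastC-∅ d
lastC-inj (suc d) (suc j) M = lastC-inj d j M

initC-last : ∀ d M → initC d (single (lastVar d) M) ≡ ∅
initC-last zero M = refl
initC-last (suc d) M = cong ([] ∷v_) (initC-last d M)

lastC-last : ∀ d M → lastC d (single (lastVar d) M) ≡ M
lastC-last zero M = refl
lastC-last (suc d) M = lastC-last d M

∅-⊎c-∅ : ∀ {n} → (∅ {n} ⊎c ∅) ≡ ∅
∅-⊎c-∅ {zero} = refl
∅-⊎c-∅ {suc n} = cong ([] ∷v_) ∅-⊎c-∅

·c-∅ : ∀ {n} u → (u ·c ∅ {n}) ≡ ∅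
·c-∅ {zero} u = refl
·c-∅ {suc n} u = cong ([] ∷v_) (·c-∅ u)

++∅-⊎ : ∀ {k n} (Γ Δ : Ctx k) → (Γ ⊎c Δ) ++v ∅ {n} ≡ (Γ ++v ∅) ⊎c (Δ ++v ∅)
++∅-⊎ []v []v = sym ∅-⊎c-∅
++∅-⊎ (x ∷v xs) (y ∷v ys) = cong (_ ∷v_) (++∅-⊎ xs ys)

++∅-· : ∀ {k n} u (Γ : Ctx k) → (u ·c Γ) ++v ∅ {n} ≡ u ·c (Γ ++v ∅)
++∅-· u []v = sym (·c-∅ u)
++∅-· u (x ∷v xs) = cong (_ ∷v_) (++∅-· u xs)

∅++∅ : ∀ {k n} → ∅ {k} ++v ∅ {n} ≡ ∅
∅++∅ {zero} = refl
∅++∅ {suc k} = cong ([] ∷v_) (∅++∅ {k})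

single-++ : ∀ {k n} (j : Fin k) M → single j M ++v ∅ {n} ≡ single (j ↑ˡ n) M
single-++ {suc k} zero M = cong (M ∷v_) (∅++∅ {k})
single-++ {suc k} (suc j) M = cong ([] ∷v_) (single-++ j M)

scaleI-++ : ∀ c L1 L2 → scaleI c (L1 ++ L2) ≡ scaleI c L1 ++ scaleI c L2
scaleI-++ c = map-++ (map₁ (c *_))

scaleI-* : ∀ c q L → scaleI c (scaleI q L) ≡ scaleI (c * q) L
scaleI-* c q [] = refl
scaleI-* c q ((p , A) ∷ L) = cong₂ _∷_ (cong (_, A) (sym (*-assoc c q p))) (scaleI-* c q L)

scaleI-identity : ∀ L → scaleI 1ℚ L ≡ L
scaleI-identity [] = refl
scaleI-identity ((q , A) ∷ L) = cong₂ _∷_ (cong (_, A) (*-identityˡ q)) (scaleI-identity L)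

scaleD-++ : ∀ c L1 L2 → scaleD c (L1 ++ L2) ≡ scaleD c L1 ++ scaleD c L2
scaleD-++ c = map-++ (map₁ (c *_))

scaleD-* : ∀ c q L → scaleD c (scaleD q L) ≡ scaleD (c * q) L
scaleD-* c q [] = refl
scaleD-* c q ((p , A) ∷ L) = cong₂ _∷_ (cong (_, A) (sym (*-assoc c q p))) (scaleD-* c q L)

scaleD-identity : ∀ L → scaleD 1ℚ L ≡ L
scaleD-identity [] = refl
scaleD-identity ((q , A) ∷ L) = cong₂ _∷_ (cong (_, A) (*-identityˡ q)) (scaleD-identity L)

norm-++ : ∀ a b → norm (a ++ b) ≡ norm a + norm b
norm-++ [] b = sym (+-identityˡ _)
norm-++ ((p , M) ∷ a) b = trans (cong (p +_) (norm-++ a b))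
  (solve 3 (λ x y z → x :+ (y :+ z) := (x :+ y) :+ z) refl p (norm a) (norm b))

norm-scale : ∀ u a → norm (scaleD u a) ≡ u * norm a
norm-scale u [] = sym (*-zeroʳ u)
norm-scale u ((p , M) ∷ a) = trans (cong (u * p +_) (norm-scale u a))
  (sym (*-distribˡ-+ u p (norm a)))

norm-scaleD-++ : ∀ p a L → norm (scaleD p a ++ L) ≡ p * norm a + norm L
norm-scaleD-++ p a L = trans (norm-++ (scaleD p a) L) (cong (_+ norm L) (norm-scale p a))

_≈qA_ : (ℚ × Arrow) → (ℚ × Arrow) → Set
x ≈qA y = (proj₁ x ≡ proj₁ y) × (proj₂ x ≈A proj₂ y)

_≈pI_ : (ℚ × Inter) → (ℚ × Inter) → Set
x ≈pI y = (proj₁ x ≡ proj₁ y) × (proj₂ x ≈I proj₂ y)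

mutual
  ≈A-refl : ∀ A → A ≈A A
  ≈A-refl (M ⇒ a) = arr≈ (≈I-refl M) (≈D-refl a)

  ≈I-refl : ∀ M → M ≈I M
  ≈I-refl M = inter≈ (prefl (pointwise-≈qA-refl M))

  pointwise-≈qA-refl : ∀ M → Pointwise _≈qA_ M M
  pointwise-≈qA-refl [] = []
  pointwise-≈qA-refl ((q , A) ∷ M) = (refl , ≈A-refl A) ∷ pointwise-≈qA-refl M

  ≈D-refl : ∀ a → a ≈D a
  ≈D-refl a = dist≈ (prefl (pointwise-≈pI-refl a))

  pointwise-≈pI-refl : ∀ a → Pointwise _≈pI_ a a
  pointwise-≈pI-refl [] = []
  pointwise-≈pI-refl ((q , M) ∷ a) = (refl , ≈I-refl M) ∷ pointwise-≈pI-refl a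

≈qA-refl : ∀ x → x ≈qA x
≈qA-refl (q , A) = refl , ≈A-refl A

≈pI-refl : ∀ x → x ≈pI x
≈pI-refl (q , M) = refl , ≈I-refl M

mutual
  ≈A-sym : ∀ {A B} → A ≈A B → B ≈A A
  ≈A-sym (arr≈ i d) = arr≈ (≈I-sym i) (≈D-sym d)

  ≈I-sym : ∀ {M M'} → M ≈I M' → M' ≈I M
  ≈I-sym (inter≈ p) = inter≈ (perm-≈qA-sym p)

  perm-≈qA-sym : ∀ {M M'} → Permutation _≈qA_ M M' → Permutation _≈qA_ M' M
  perm-≈qA-sym (prefl pw) = prefl (pointwise-≈qA-sym pw)
  perm-≈qA-sym (prep (e , r) p) = prep (sym e , ≈A-sym r) (perm-≈qA-sym p)
  perm-≈qA-sym (swap (e1 , r1) (e2 , r2) p) = swap (sym e2 , ≈A-sym r2) (sym e1 , ≈A-sym r1) (perm-≈qA-sym p)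
  perm-≈qA-sym (ptrans p q) = ptrans (perm-≈qA-sym q) (perm-≈qA-sym p)

  pointwise-≈qA-sym : ∀ {M M'} → Pointwise _≈qA_ M M' → Pointwise _≈qA_ M' M
  pointwise-≈qA-sym [] = []
  pointwise-≈qA-sym ((e , r) ∷ pw) = (sym e , ≈A-sym r) ∷ pointwise-≈qA-sym pw

  ≈D-sym : ∀ {a b} → a ≈D b → b ≈D a
  ≈D-sym (dist≈ p) = dist≈ (perm-≈pI-sym p)

  perm-≈pI-sym : ∀ {a b} → Permutation _≈pI_ a b → Permutation _≈pI_ b a
  perm-≈pI-sym (prefl pw) = prefl (pointwise-≈pI-sym pw)
  perm-≈pI-sym (prep (e , r) p) = prep (sym e , ≈I-sym r) (perm-≈pI-sym p)
  perm-≈pI-sym (swap (e1 , r1) (e2 , r2) p) = swap (sym e2 , ≈I-sym r2) (sym e1 , ≈I-sym r1) (perm-≈pI-sym p)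
  perm-≈pI-sym (ptrans p q) = ptrans (perm-≈pI-sym q) (perm-≈pI-sym p)

  pointwise-≈pI-sym : ∀ {a b} → Pointwise _≈pI_ a b → Pointwise _≈pI_ b a
  pointwise-≈pI-sym [] = []
  pointwise-≈pI-sym ((e , r) ∷ pw) = (sym e , ≈I-sym r) ∷ pointwise-≈pI-sym pw

≈A-trans : ∀ {A B C} → A ≈A B → B ≈A C → A ≈A C
≈A-trans (arr≈ (inter≈ p) (dist≈ q)) (arr≈ (inter≈ p') (dist≈ q')) =
  arr≈ (inter≈ (ptrans p p')) (dist≈ (ptrans q q'))

≈I-trans : ∀ {A B C} → A ≈I B → B ≈I C → A ≈I C
≈I-trans (inter≈ p) (inter≈ q) = inter≈ (ptrans p q)

≈D-trans : ∀ {A B C} → A ≈D B → B ≈D C → A ≈D C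
≈D-trans (dist≈ p) (dist≈ q) = dist≈ (ptrans p q)

≈qA-trans : ∀ {x y z} → x ≈qA y → y ≈qA z → x ≈qA z
≈qA-trans (e , r) (e' , r') = trans e e' , ≈A-trans r r'

≈pI-trans : ∀ {x y z} → x ≈pI y → y ≈pI z → x ≈pI z
≈pI-trans (e , r) (e' , r') = trans e e' , ≈I-trans r r'

-- Every R-permutation factors as a permutation up to _≡_ followed by a
-- pointwise R-step, so the library lemmas on _↭_ apply.
module PermutationNF {A : Set} (R : A → A → Set) (Rrefl : ∀ x → R x x)
           (Rtrans : ∀ {x y z} → R x y → R y z → R x z) where

  NF : List A → List A → Set
  NF xs ys = ∃ λ zs → (xs ↭ zs) × Pointwise R zs ys

  pointwise-↭-commute : ∀ {as ys bs} → Pointwise R as ys → ys ↭ bs → ∃ λ as' → (as ↭ as') × Pointwise R as' bs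
  pointwise-↭-commute pw ↭refl = _ , ↭refl , pw
  pointwise-↭-commute (r ∷ pw) (↭prep x p) with pointwise-↭-commute pw p
  ... | as' , q , pw' = _ , ↭prep _ q , r ∷ pw'
  pointwise-↭-commute (r1 ∷ r2 ∷ pw) (↭swap x y p) with pointwise-↭-commute pw p
  ... | as' , q , pw' = _ , ↭swap _ _ q , r2 ∷ r1 ∷ pw'
  pointwise-↭-commute pw (↭trans p q) with pointwise-↭-commute pw p
  ... | as1 , q1 , pw1 with pointwise-↭-commute pw1 q
  ... | as2 , q2 , pw2 = as2 , ↭trans q1 q2 , pw2

  toNF : ∀ {xs ys} → Permutation R xs ys → NF xs ys
  toNF (prefl pw) = _ , ↭refl , pw
  toNF (prep r p) with toNF p
  ... | zs , q , pw = _ , ↭prep _ q , r ∷ pw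
  toNF (swap r1 r2 p) with toNF p
  ... | zs , q , pw = _ , ↭swap _ _ q , r2 ∷ r1 ∷ pw
  toNF (ptrans p q) with toNF p | toNF q
  ... | a , p1 , pw1 | b , q1 , pw2 with pointwise-↭-commute pw1 q1
  ... | a' , p2 , pw3 = a' , ↭trans p1 p2 , Pw.transitive Rtrans pw3 pw2

  ↭⇒perm : ∀ {xs ys} → xs ↭ ys → Permutation R xs ys
  ↭⇒perm ↭refl = prefl (Pw.refl (Rrefl _))
  ↭⇒perm (↭prep x p) = prep (Rrefl x) (↭⇒perm p)
  ↭⇒perm (↭swap x y p) = swap (Rrefl x) (Rrefl y) (↭⇒perm p)
  ↭⇒perm (↭trans p q) = ptrans (↭⇒perm p) (↭⇒perm q)

  pointwise-++-split : ∀ {zs} ys1 ys2 → Pointwise R zs (ys1 ++ ys2) →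
    ∃ λ zs1 → ∃ λ zs2 → (zs ≡ zs1 ++ zs2) × Pointwise R zs1 ys1 × Pointwise R zs2 ys2
  pointwise-++-split [] ys2 pw = [] , _ , refl , [] , pw
  pointwise-++-split (y ∷ ys1) ys2 (r ∷ pw) with pointwise-++-split ys1 ys2 pw
  ... | zs1 , zs2 , refl , p1 , p2 = _ ∷ zs1 , zs2 , refl , r ∷ p1 , p2

  perm-++ : ∀ {xs ys zs ws} → Permutation R xs ys → Permutation R zs ws → Permutation R (xs ++ zs) (ys ++ ws)
  perm-++ p q with toNF p | toNF q
  ... | _ , p1 , pw1 | _ , q1 , pw2 = ptrans (↭⇒perm (↭-++⁺ p1 q1)) (prefl (Pw.++⁺ pw1 pw2))

  perm-map : (f : A → A) → (∀ {x y} → R x y → R (f x) (f y)) →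
    ∀ {xs ys} → Permutation R xs ys → Permutation R (map f xs) (map f ys)
  perm-map f fr (prefl pw) = prefl (Pw.map⁺ f f (Pw.map fr pw))
  perm-map f fr (prep r p) = prep (fr r) (perm-map f fr p)
  perm-map f fr (swap r1 r2 p) = swap (fr r1) (fr r2) (perm-map f fr p)
  perm-map f fr (ptrans p q) = ptrans (perm-map f fr p) (perm-map f fr q)

module PermA = PermutationNF _≈qA_ ≈qA-refl ≈qA-trans
module PermI = PermutationNF _≈pI_ ≈pI-refl ≈pI-trans

≈I-++ : ∀ {a b c d} → a ≈I b → c ≈I d → (a ++ c) ≈I (b ++ d)
≈I-++ (inter≈ p) (inter≈ q) = inter≈ (PermA.perm-++ p q)

≈D-++ : ∀ {a b c d} → a ≈D b → c ≈D d → (a ++ c) ≈D (b ++ d)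
≈D-++ (dist≈ p) (dist≈ q) = dist≈ (PermI.perm-++ p q)

≈I-scale : ∀ u {a b} → a ≈I b → scaleI u a ≈I scaleI u b
≈I-scale u (inter≈ p) = inter≈ (PermA.perm-map (map₁ (u *_)) (λ { (e , r) → cong (u *_) e , r }) p)

≈D-scale : ∀ u {a b} → a ≈D b → scaleD u a ≈D scaleD u b
≈D-scale u (dist≈ p) = dist≈ (PermI.perm-map (map₁ (u *_)) (λ { (e , r) → cong (u *_) e , r }) p)

≈D-reflexive : ∀ {a b} → a ≡ b → a ≈D b
≈D-reflexive {a} refl = ≈D-refl a

↭⇒≈D : ∀ {a b} → a ↭ b → a ≈D b
↭⇒≈D p = dist≈ (PermI.↭⇒perm p)

↭⇒≈I : ∀ {a b} → a ↭ b → a ≈I b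
↭⇒≈I p = inter≈ (PermA.↭⇒perm p)

norm-pointwise : ∀ {a b} → Pointwise _≈pI_ a b → norm a ≡ norm b
norm-pointwise [] = refl
norm-pointwise ((e , _) ∷ pw) = cong₂ _+_ e (norm-pointwise pw)

norm-≈D : ∀ {a b} → a ≈D b → norm a ≡ norm b
norm-≈D (dist≈ p) = go p
  where
  go : ∀ {a b} → Permutation _≈pI_ a b → norm a ≡ norm b
  go (prefl pw) = norm-pointwise pw
  go (prep (e , _) p) = cong₂ _+_ e (go p)
  go (swap {x = x} {y = y} (e1 , _) (e2 , _) p) =
    trans (solve 3 (λ a b c → a :+ (b :+ c) := b :+ (a :+ c)) refl (proj₁ x) (proj₁ y) _)
          (cong₂ _+_ e2 (cong₂ _+_ e1 (go p)))
  go (ptrans p q) = trans (go p) (go q)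

perm-[]-inv : ∀ {A : Set} {R : A → A → Set} {xs} → Permutation R xs [] → xs ≡ []
perm-[]-inv (prefl []) = refl
perm-[]-inv (ptrans p q) rewrite perm-[]-inv q = perm-[]-inv p

≈I-[]-inv : ∀ {M} → M ≈I [] → M ≡ []
≈I-[]-inv (inter≈ p) = perm-[]-inv p

tight-≈D : ∀ {a b} → a ≈D b → Tight b → Tight a
tight-≈D (dist≈ p) = go p
  where
  go : ∀ {a b} → Permutation _≈pI_ a b → Tight b → Tight a
  go (prefl pw) t = gpw pw t
    where
    gpw : ∀ {a b} → Pointwise _≈pI_ a b → Tight b → Tight a
    gpw [] [] = []
    gpw ((_ , r) ∷ pw) (e ∷ t) = ≈I-[]-inv (subst (_ ≈I_) e r) ∷ gpw pw t
  go (prep (_ , r) p) (e ∷ t) = ≈I-[]-inv (subst (_ ≈I_) e r) ∷ go p t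
  go (swap (_ , r1) (_ , r2) p) (e2 ∷ e1 ∷ t) =
    ≈I-[]-inv (subst (_ ≈I_) e1 r1) ∷ ≈I-[]-inv (subst (_ ≈I_) e2 r2) ∷ go p t
  go (ptrans p q) t = go p (go q t)

CtxEq : ∀ {n} → Ctx n → Ctx n → Set
CtxEq []v []v = ⊤
CtxEq (x ∷v xs) (y ∷v ys) = (x ≈I y) × CtxEq xs ys

ceq-refl : ∀ {n} (Γ : Ctx n) → CtxEq Γ Γ
ceq-refl []v = tt
ceq-refl (x ∷v xs) = ≈I-refl x , ceq-refl xs

ceq-≡ : ∀ {n} {Γ Δ : Ctx n} → Γ ≡ Δ → CtxEq Γ Δ
ceq-≡ {Γ = Γ} refl = ceq-refl Γ

ceq-trans : ∀ {n} {Γ Δ Θ : Ctx n} → CtxEq Γ Δ → CtxEq Δ Θ → CtxEq Γ Θ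
ceq-trans {Γ = []v} {[]v} {[]v} _ _ = tt
ceq-trans {Γ = _ ∷v _} {_ ∷v _} {_ ∷v _} (a , b) (c , d) = ≈I-trans a c , ceq-trans b d

ceq-⊎ : ∀ {n} {Γ Γ' Δ Δ' : Ctx n} → CtxEq Γ Γ' → CtxEq Δ Δ' → CtxEq (Γ ⊎c Δ) (Γ' ⊎c Δ')
ceq-⊎ {Γ = []v} {[]v} {[]v} {[]v} _ _ = tt
ceq-⊎ {Γ = _ ∷v _} {_ ∷v _} {_ ∷v _} {_ ∷v _} (a , b) (c , d) = ≈I-++ a c , ceq-⊎ b d

ceq-· : ∀ {n} u {Γ Γ' : Ctx n} → CtxEq Γ Γ' → CtxEq (u ·c Γ) (u ·c Γ')
ceq-· u {[]v} {[]v} _ = tt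
ceq-· u {_ ∷v _} {_ ∷v _} (a , b) = ≈I-scale u a , ceq-· u b

mutual
  sizeT : ∀ {n} {Γ : Ctx n} {w M a} → DerT Γ w M a → ℕ
  sizeT zero-rule = 0
  sizeT (app-rule dv dw _) = suc (sizeI dv N.+ sizeI dw)
  sizeT (⊕-rule d1 d2) = suc (sizeT d1 N.+ sizeT d2)
  sizeT (let-rule dn br) = suc (sizeT dn N.+ sizeBr br)
  sizeT (val-rule d) = suc (sizeI d)

  sizeI : ∀ {n} {Γ : Ctx n} {w V M} → DerI Γ w V M → ℕ
  sizeI (var-rule _) = 0
  sizeI (!-rule b) = sizeB b

  sizeB : ∀ {n} {Γ : Ctx n} {w V M} → Bang Γ w V M → ℕ
  sizeB bang-nil = 0
  sizeB (bang-cons _ da b) = sizeA da N.+ sizeB b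

  sizeA : ∀ {n} {Γ : Ctx n} {w V A} → DerA Γ w V A → ℕ
  sizeA (λ-rule d) = suc (sizeT d)

  sizeBr : ∀ {n} {M : Term (suc n)} {a Δ ws b} → Branches M a Δ ws b → ℕ
  sizeBr br-nil = 0
  sizeBr (br-cons d _ br) = sizeT d N.+ sizeBr br

castCtxT : ∀ {n} {Γ Γ' : Ctx n} {w M a} → Γ ≡ Γ' → DerT Γ w M a → DerT Γ' w M a
castCtxT refl d = d

castCtxT-size : ∀ {n} {Γ Γ' : Ctx n} {w M a} (e : Γ ≡ Γ') (d : DerT Γ w M a) → sizeT (castCtxT e d) ≡ sizeT d
castCtxT-size refl d = refl

castCtxI : ∀ {n} {Γ Γ' : Ctx n} {w V M} → Γ ≡ Γ' → DerI Γ w V M → DerI Γ' w V M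
castCtxI refl d = d

castCtxI-size : ∀ {n} {Γ Γ' : Ctx n} {w V M} (e : Γ ≡ Γ') (d : DerI Γ w V M) → sizeI (castCtxI e d) ≡ sizeI d
castCtxI-size refl d = refl

castCtxB : ∀ {n} {Γ Γ' : Ctx n} {w V M} → Γ ≡ Γ' → Bang Γ w V M → Bang Γ' w V M
castCtxB refl d = d

castCtxB-size : ∀ {n} {Γ Γ' : Ctx n} {w V M} (e : Γ ≡ Γ') (d : Bang Γ w V M) → sizeB (castCtxB e d) ≡ sizeB d
castCtxB-size refl d = refl

castCtxBr : ∀ {n} {M : Term (suc n)} {a Δ Δ' ws b} → Δ ≡ Δ' → Branches M a Δ ws b → Branches M a Δ' ws b
castCtxBr refl d = d

castCtxBr-size : ∀ {n} {M : Term (suc n)} {a Δ Δ' ws b} (e : Δ ≡ Δ') (d : Branches M a Δ ws b) →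
  sizeBr (castCtxBr e d) ≡ sizeBr d
castCtxBr-size refl d = refl

castValI : ∀ {n} {Γ : Ctx n} {w V V' M} → V ≡ V' → DerI Γ w V M → DerI Γ w V' M
castValI refl d = d

castValI-size : ∀ {n} {Γ : Ctx n} {w V V' M} (e : V ≡ V') (d : DerI Γ w V M) → sizeI (castValI e d) ≡ sizeI d
castValI-size refl d = refl

castTermT : ∀ {n} {Γ : Ctx n} {w M M' a} → M ≡ M' → DerT Γ w M a → DerT Γ w M' a
castTermT refl d = d

castTermT-size : ∀ {n} {Γ : Ctx n} {w M M' a} (e : M ≡ M') (d : DerT Γ w M a) → sizeT (castTermT e d) ≡ sizeT d
castTermT-size refl d = refl

WFCtx : ∀ {n} → Ctx n → Set
WFCtx []v = ⊤
WFCtx (x ∷v xs) = WFInter x × WFCtx xs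

WFInter-++ : ∀ {a b} → WFInter a → WFInter b → WFInter (a ++ b)
WFInter-++ {[]} _ h = h
WFInter-++ {(q , A) ∷ a} (u , w , r) h = u , w , WFInter-++ r h

WFInter-scale : ∀ {u} a → InUnit u → WFInter a → WFInter (scaleI u a)
WFInter-scale [] iu _ = tt
WFInter-scale ((q , A) ∷ a) iu (u , w , r) = InUnit-* iu u , w , WFInter-scale a iu r

WFDist'-++ : ∀ {a b} → WFDist' a → WFDist' b → WFDist' (a ++ b)
WFDist'-++ {[]} _ h = h
WFDist'-++ {(q , A) ∷ a} (u , w , r) h = u , w , WFDist'-++ r h

WFDist'-scale : ∀ {u} a → InUnit u → WFDist' a → WFDist' (scaleD u a)
WFDist'-scale [] iu _ = tt
WFDist'-scale ((q , A) ∷ a) iu (u , w , r) = InUnit-* iu u , w , WFDist'-scale a iu r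

WFCtx-∅ : ∀ {n} → WFCtx (∅ {n})
WFCtx-∅ {zero} = tt
WFCtx-∅ {suc n} = tt , WFCtx-∅

WFCtx-⊎ : ∀ {n} {Γ Δ : Ctx n} → WFCtx Γ → WFCtx Δ → WFCtx (Γ ⊎c Δ)
WFCtx-⊎ {Γ = []v} {[]v} _ _ = tt
WFCtx-⊎ {Γ = _ ∷v _} {_ ∷v _} (a , b) (c , d) = WFInter-++ a c , WFCtx-⊎ b d

WFCtx-· : ∀ {n u} {Γ : Ctx n} → InUnit u → WFCtx Γ → WFCtx (u ·c Γ)
WFCtx-· {Γ = []v} _ _ = tt
WFCtx-· {Γ = x ∷v _} iu (a , b) = WFInter-scale x iu a , WFCtx-· iu b

WFCtx-single : ∀ {n} (x : Fin n) {M} → WFInter M → WFCtx (single x M)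
WFCtx-single zero h = h , WFCtx-∅
WFCtx-single (suc x) h = tt , WFCtx-single x h

mutual
  derT-wf : ∀ {n} {Γ : Ctx n} {w M a} → DerT Γ w M a → WFCtx Γ × WFDist a
  derT-wf zero-rule = WFCtx-∅ , tt , 0≤1
  derT-wf (app-rule dv dw _) with derI-wf dv | derI-wf dw
  ... | c1 , (_ , (_ , wb) , _) | c2 , _ = WFCtx-⊎ c1 c2 , wb
  derT-wf (⊕-rule {a = a} {b = b} d1 d2) with derT-wf d1 | derT-wf d2
  ... | c1 , (w1 , n1) | c2 , (w2 , n2) =
    WFCtx-⊎ (WFCtx-· InUnit-½ c1) (WFCtx-· InUnit-½ c2) ,
    WFDist'-++ (WFDist'-scale a InUnit-½ w1) (WFDist'-scale b InUnit-½ w2) ,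
    ≤-trans (≤-reflexive (trans (norm-++ (scaleD ½ a) (scaleD ½ b))
                                (cong₂ _+_ (norm-scale ½ a) (norm-scale ½ b))))
            (+-mono-≤ (*-monoˡ-≤-nonneg (<⇒≤ (proj₁ InUnit-½)) n1) (*-monoˡ-≤-nonneg (<⇒≤ (proj₁ InUnit-½)) n2))
  derT-wf (let-rule dn br) with derT-wf dn
  ... | c1 , (w1 , n1) with branches-wf br w1
  ... | c2 , w2 , n2 = WFCtx-⊎ c1 c2 , w2 , ≤-trans n2 n1
  derT-wf (val-rule d) with derI-wf d
  ... | c , m = c , (InUnit-1 , m , tt) , ≤-reflexive (+-identityʳ 1ℚ)

  derI-wf : ∀ {n} {Γ : Ctx n} {w V M} → DerI Γ w V M → WFCtx Γ × WFInter M
  derI-wf (var-rule {x = x} h) = WFCtx-single x h , h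
  derI-wf (!-rule b) = bang-wf b

  bang-wf : ∀ {n} {Γ : Ctx n} {w V M} → Bang Γ w V M → WFCtx Γ × WFInter M
  bang-wf bang-nil = WFCtx-∅ , tt
  bang-wf (bang-cons iu da b) with derA-wf da | bang-wf b
  ... | c1 , wa | c2 , wm = WFCtx-⊎ (WFCtx-· iu c1) c2 , iu , wa , wm

  derA-wf : ∀ {n} {Γ : Ctx n} {w V A} → DerA Γ w V A → WFCtx Γ × WFArrow A
  derA-wf (λ-rule d) with derT-wf d
  ... | (wx , c) , wb = c , wx , wb

  branches-wf : ∀ {n} {M : Term (suc n)} {a Δ ws b} → Branches M a Δ ws b → WFDist' a →
         WFCtx Δ × WFDist' b × (norm b ≤ norm a)
  branches-wf br-nil _ = WFCtx-∅ , tt , ≤-refl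
  branches-wf (br-cons {p = p} {b = b} {bs = bs} {a = a} d _ br) (iu , _ , wa) with derT-wf d | branches-wf br wa
  ... | (_ , c1) , (w1 , n1) | c2 , w2 , n2 =
    WFCtx-⊎ (WFCtx-· iu c1) c2 , WFDist'-++ (WFDist'-scale b iu w1) w2 ,
    ≤-trans (≤-reflexive (trans (norm-++ (scaleD p b) bs) (cong (_+ norm bs) (norm-scale p b))))
      (+-mono-≤ (≤-trans (*-monoˡ-≤-nonneg (<⇒≤ (proj₁ iu)) n1) (≤-reflexive (*-identityʳ p))) n2)

ext-↑ˡ : ∀ {k n} {ρ : Fin k → Fin (k N.+ n)} → (∀ i → ρ i ≡ i ↑ˡ n) → ∀ i → ext ρ i ≡ i ↑ˡ n
ext-↑ˡ e zero = refl
ext-↑ˡ e (suc i) = cong suc (e i)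

⊕-ctx : ∀ {n} (Γ Δ : Ctx n) → Ctx n
⊕-ctx Γ Δ = (½ ·c Γ) ⊎c (½ ·c Δ)

++∅-⊕ : ∀ {k n} (Γ Δ : Ctx k) → ⊕-ctx Γ Δ ++v ∅ {n} ≡ ⊕-ctx (Γ ++v ∅) (Δ ++v ∅)
++∅-⊕ Γ Δ = trans (++∅-⊎ (½ ·c Γ) (½ ·c Δ)) (cong₂ _⊎c_ (++∅-· ½ Γ) (++∅-· ½ Δ))

++∅-·⊎ : ∀ {k n} q (Γ Δ : Ctx k) → ((q ·c Γ) ⊎c Δ) ++v ∅ {n} ≡ (q ·c (Γ ++v ∅)) ⊎c (Δ ++v ∅)
++∅-·⊎ q Γ Δ = trans (++∅-⊎ (q ·c Γ) Δ) (cong (_⊎c (Δ ++v ∅)) (++∅-· q Γ))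

mutual
  weakenT : ∀ {k n} {ρ : Fin k → Fin (k N.+ n)} → (∀ i → ρ i ≡ i ↑ˡ n) →
        ∀ {Γ w M a} → DerT Γ w M a → DerT (Γ ++v ∅ {n}) w (renT ρ M) a
  weakenT {k} {n} e zero-rule = castCtxT (sym (∅++∅ {k} {n})) zero-rule
  weakenT e (app-rule {Γ = Γ} {Δ} dv dw q) = castCtxT (sym (++∅-⊎ Γ Δ)) (app-rule (weakenI e dv) (weakenI e dw) q)
  weakenT e (⊕-rule {Γ = Γ} {Δ} d1 d2) = castCtxT (sym (++∅-⊕ Γ Δ)) (⊕-rule (weakenT e d1) (weakenT e d2))
  weakenT e (let-rule {Γ = Γ} {Δ} dn br) = castCtxT (sym (++∅-⊎ Γ Δ)) (let-rule (weakenT e dn) (weakenBr e br))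
  weakenT e (val-rule d) = val-rule (weakenI e d)

  weakenI : ∀ {k n} {ρ : Fin k → Fin (k N.+ n)} → (∀ i → ρ i ≡ i ↑ˡ n) →
        ∀ {Γ w V M} → DerI Γ w V M → DerI (Γ ++v ∅ {n}) w (renV ρ V) M
  weakenI e (var-rule {x = x} {M = M} h) =
    castCtxI (trans (cong (λ y → single y M) (e x)) (sym (single-++ x M))) (var-rule h)
  weakenI e (!-rule b) = !-rule (weakenB e b)

  weakenB : ∀ {k n} {ρ : Fin k → Fin (k N.+ n)} → (∀ i → ρ i ≡ i ↑ˡ n) →
        ∀ {Γ w V M} → Bang Γ w V M → Bang (Γ ++v ∅ {n}) w (renV ρ V) M
  weakenB {k} {n} e bang-nil = castCtxB (sym (∅++∅ {k} {n})) bang-nil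
  weakenB e (bang-cons {Γ = Γ} {Δ} {q = q} iu da b) = castCtxB (sym (++∅-·⊎ q Γ Δ))
    (bang-cons iu (weakenA e da) (weakenB e b))

  weakenA : ∀ {k n} {ρ : Fin k → Fin (k N.+ n)} → (∀ i → ρ i ≡ i ↑ˡ n) →
        ∀ {Γ w V A} → DerA Γ w V A → DerA (Γ ++v ∅ {n}) w (renV ρ V) A
  weakenA e (λ-rule d) = λ-rule (weakenT (ext-↑ˡ e) d)

  weakenBr : ∀ {k n} {ρ : Fin k → Fin (k N.+ n)} → (∀ i → ρ i ≡ i ↑ˡ n) →
        ∀ {M a Δ ws b} → Branches M a Δ ws b → Branches (renT (ext ρ) M) a (Δ ++v ∅ {n}) ws b
  weakenBr {k} {n} e br-nil = castCtxBr (sym (∅++∅ {k} {n})) br-nil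
  weakenBr e (br-cons {p = p} {Δ = Δ} {Δs = Δs} d q br) = castCtxBr (sym (++∅-·⊎ p Δ Δs))
    (br-cons (weakenT (ext-↑ˡ e) d) q (weakenBr e br))

mutual
  weakenT-size : ∀ {k n} {ρ : Fin k → Fin (k N.+ n)} (e : ∀ i → ρ i ≡ i ↑ˡ n) →
        ∀ {Γ w M a} (d : DerT Γ w M a) → sizeT (weakenT e d) ≡ sizeT d
  weakenT-size {k} {n} e zero-rule = castCtxT-size (sym (∅++∅ {k} {n})) zero-rule
  weakenT-size e (app-rule {Γ = Γ} {Δ} dv dw q) =
    trans (castCtxT-size (sym (++∅-⊎ Γ Δ)) _) (cong suc (cong₂ N._+_ (weakenI-size e dv) (weakenI-size e dw)))
  weakenT-size e (⊕-rule {Γ = Γ} {Δ} d1 d2) =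
    trans (castCtxT-size (sym (++∅-⊕ Γ Δ)) _) (cong suc (cong₂ N._+_ (weakenT-size e d1) (weakenT-size e d2)))
  weakenT-size e (let-rule {Γ = Γ} {Δ} dn br) =
    trans (castCtxT-size (sym (++∅-⊎ Γ Δ)) _) (cong suc (cong₂ N._+_ (weakenT-size e dn) (weakenBr-size e br)))
  weakenT-size e (val-rule d) = cong suc (weakenI-size e d)

  weakenI-size : ∀ {k n} {ρ : Fin k → Fin (k N.+ n)} (e : ∀ i → ρ i ≡ i ↑ˡ n) →
        ∀ {Γ w V M} (d : DerI Γ w V M) → sizeI (weakenI e d) ≡ sizeI d
  weakenI-size e (var-rule {x = x} {M = M} h) =
    castCtxI-size (trans (cong (λ y → single y M) (e x)) (sym (single-++ x M))) (var-rule h)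
  weakenI-size e (!-rule b) = weakenB-size e b

  weakenB-size : ∀ {k n} {ρ : Fin k → Fin (k N.+ n)} (e : ∀ i → ρ i ≡ i ↑ˡ n) →
        ∀ {Γ w V M} (d : Bang Γ w V M) → sizeB (weakenB e d) ≡ sizeB d
  weakenB-size {k} {n} e bang-nil = castCtxB-size (sym (∅++∅ {k} {n})) bang-nil
  weakenB-size e (bang-cons {Γ = Γ} {Δ} {q = q} iu da b) =
    trans (castCtxB-size (sym (++∅-·⊎ q Γ Δ)) _) (cong₂ N._+_ (weakenA-size e da) (weakenB-size e b))

  weakenA-size : ∀ {k n} {ρ : Fin k → Fin (k N.+ n)} (e : ∀ i → ρ i ≡ i ↑ˡ n) →
        ∀ {Γ w V A} (d : DerA Γ w V A) → sizeA (weakenA e d) ≡ sizeA d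
  weakenA-size e (λ-rule d) = cong suc (weakenT-size (ext-↑ˡ e) d)

  weakenBr-size : ∀ {k n} {ρ : Fin k → Fin (k N.+ n)} (e : ∀ i → ρ i ≡ i ↑ˡ n) →
        ∀ {M a Δ ws b} (d : Branches M a Δ ws b) → sizeBr (weakenBr e d) ≡ sizeBr d
  weakenBr-size {k} {n} e br-nil = castCtxBr-size (sym (∅++∅ {k} {n})) br-nil
  weakenBr-size e (br-cons {p = p} {Δ = Δ} {Δs = Δs} d q br) =
    trans (castCtxBr-size (sym (++∅-·⊎ p Δ Δs)) _) (cong₂ N._+_ (weakenT-size (ext-↑ˡ e) d) (weakenBr-size e br))

mutual
  unweakenT : ∀ {k n} {ρ : Fin k → Fin (k N.+ n)} → (∀ i → ρ i ≡ i ↑ˡ n) →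
        ∀ (M : Term k) {Γ w a} → DerT Γ w (renT ρ M) a →
        ∃ λ Γ0 → (Γ ≡ Γ0 ++v ∅ {n}) × DerT Γ0 w M a
  unweakenT {k} {n} e (val _) zero-rule = ∅ , sym (∅++∅ {k} {n}) , zero-rule
  unweakenT {k} {n} e (app _ _) zero-rule = ∅ , sym (∅++∅ {k} {n}) , zero-rule
  unweakenT {k} {n} e (_ ⊕ _) zero-rule = ∅ , sym (∅++∅ {k} {n}) , zero-rule
  unweakenT {k} {n} e (let' _ _) zero-rule = ∅ , sym (∅++∅ {k} {n}) , zero-rule
  unweakenT e (val V) (val-rule d) with unweakenI e V d
  ... | G , eq , d' = G , eq , val-rule d'
  unweakenT e (app V W) (app-rule dv dw q) with unweakenI e V dv | unweakenI e W dw
  ... | G1 , e1 , d1 | G2 , e2 , d2 = G1 ⊎c G2 , trans (cong₂ _⊎c_ e1 e2) (sym (++∅-⊎ G1 G2)) , app-rule d1 d2 q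
  unweakenT e (M ⊕ N) (⊕-rule d1 d2) with unweakenT e M d1 | unweakenT e N d2
  ... | G1 , e1 , d1' | G2 , e2 , d2' = ⊕-ctx G1 G2 , trans (cong₂ ⊕-ctx e1 e2) (sym (++∅-⊕ G1 G2)) , ⊕-rule d1' d2'
  unweakenT e (let' N M) (let-rule dn br) with unweakenT e N dn | unweakenBr e M br
  ... | G1 , e1 , d1 | G2 , e2 , br' = G1 ⊎c G2 , trans (cong₂ _⊎c_ e1 e2) (sym (++∅-⊎ G1 G2)) , let-rule d1 br'

  unweakenI : ∀ {k n} {ρ : Fin k → Fin (k N.+ n)} → (∀ i → ρ i ≡ i ↑ˡ n) →
        ∀ (V : Val k) {Γ w M} → DerI Γ w (renV ρ V) M →
        ∃ λ Γ0 → (Γ ≡ Γ0 ++v ∅ {n}) × DerI Γ0 w V M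
  unweakenI e (var x) (var-rule {M = M} h) =
    single x M , trans (cong (λ y → single y M) (e x)) (sym (single-++ x M)) , var-rule h
  unweakenI e V (!-rule b) with unweakenB e V b
  ... | G , eq , b' = G , eq , !-rule b'

  unweakenB : ∀ {k n} {ρ : Fin k → Fin (k N.+ n)} → (∀ i → ρ i ≡ i ↑ˡ n) →
        ∀ (V : Val k) {Γ w M} → Bang Γ w (renV ρ V) M →
        ∃ λ Γ0 → (Γ ≡ Γ0 ++v ∅ {n}) × Bang Γ0 w V M
  unweakenB {k} {n} e V bang-nil = ∅ , sym (∅++∅ {k} {n}) , bang-nil
  unweakenB e V (bang-cons {q = q} iu da b) with unweakenA e V da | unweakenB e V b
  ... | G1 , e1 , d1 | G2 , e2 , d2 =
    (q ·c G1) ⊎c G2 , trans (cong₂ (λ X Y → (q ·c X) ⊎c Y) e1 e2) (sym (++∅-·⊎ q G1 G2)) , bang-cons iu d1 d2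

  unweakenA : ∀ {k n} {ρ : Fin k → Fin (k N.+ n)} → (∀ i → ρ i ≡ i ↑ˡ n) →
        ∀ (V : Val k) {Γ w A} → DerA Γ w (renV ρ V) A →
        ∃ λ Γ0 → (Γ ≡ Γ0 ++v ∅ {n}) × DerA Γ0 w V A
  unweakenA e (lam B) (λ-rule d) with unweakenT (ext-↑ˡ e) B d
  ... | (x ∷v G) , refl , d' = G , refl , λ-rule d'

  unweakenBr : ∀ {k n} {ρ : Fin k → Fin (k N.+ n)} → (∀ i → ρ i ≡ i ↑ˡ n) →
        ∀ (M : Term (suc k)) {a Δ ws b} → Branches (renT (ext ρ) M) a Δ ws b →
        ∃ λ Δ0 → (Δ ≡ Δ0 ++v ∅ {n}) × Branches M a Δ0 ws b
  unweakenBr {k} {n} e M br-nil = ∅ , sym (∅++∅ {k} {n}) , br-nil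
  unweakenBr e M (br-cons {p = p} d q br) with unweakenT (ext-↑ˡ e) M d | unweakenBr e M br
  ... | (x ∷v G) , refl , d' | G2 , refl , br' = (p ·c G) ⊎c G2 , sym (++∅-·⊎ p G G2) , br-cons d' q br'

ClosedBang : ℚ → Val 0 → Inter → Set
ClosedBang v V L = Bang []v v V L

ctx0-[] : (G : Ctx 0) → G ≡ []v
ctx0-[] []v = refl

closedDerI⇒bang : ∀ {Γ : Ctx 0} {w V Mo} → DerI Γ w V Mo → Bang Γ w V Mo
closedDerI⇒bang (!-rule b) = b

closedDerI⇒bang-size : ∀ {Γ : Ctx 0} {w V Mo} (d : DerI Γ w V Mo) → sizeB (closedDerI⇒bang d) ≡ sizeI d
closedDerI⇒bang-size (!-rule b) = refl

closeA : ∀ {G : Ctx 0} {w V A} → DerA G w V A → DerA []v w V A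
closeA {[]v} d = d

closeA-size : ∀ {G : Ctx 0} {w V A} (d : DerA G w V A) → sizeA (closeA d) ≡ sizeA d
closeA-size {[]v} d = refl

closeB : ∀ {G : Ctx 0} {w V A} → Bang G w V A → Bang []v w V A
closeB {[]v} d = d

closeB-size : ∀ {G : Ctx 0} {w V A} (d : Bang G w V A) → sizeB (closeB d) ≡ sizeB d
closeB-size {[]v} d = refl

closedBang-cons : ∀ {w v V A M q} → InUnit q → DerA []v w V A → ClosedBang v V M →
  ClosedBang ((q * w) + v) V ((q , A) ∷ M)
closedBang-cons iu da b = bang-cons {Γ = []v} {Δ = []v} iu da b

closedBang-split : ∀ {V} L1 L2 {v} {Γ : Ctx 0} (b : Bang Γ v V (L1 ++ L2)) →
  Σ ℚ λ v1 → Σ ℚ λ v2 → Σ (ClosedBang v1 V L1) λ b1 → Σ (ClosedBang v2 V L2) λ b2 →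
    (v ≡ v1 + v2) × (sizeB b ≡ sizeB b1 N.+ sizeB b2)
closedBang-split [] L2 b = 0ℚ , _ , bang-nil , closeB b , sym (+-identityˡ _) , sym (closeB-size b)
closedBang-split (x ∷ L1) L2 (bang-cons {w = w} {q = q} iu da b) with closedBang-split L1 L2 b
... | v1 , v2 , b1 , b2 , refl , s =
  q * w + v1 , v2 , closedBang-cons iu (closeA da) b1 , b2 ,
  sym (+-assoc (q * w) v1 v2) ,
  trans (cong (sizeA da N.+_) s) (trans (sym (NP.+-assoc (sizeA da) (sizeB b1) (sizeB b2)))
    (cong (λ z → z N.+ sizeB b1 N.+ sizeB b2) (sym (closeA-size da))))

closedBang-↭ : ∀ {V v L L'} {Γ : Ctx 0} (b : Bang Γ v V L) → L ↭ L' →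
  Σ ℚ λ v' → Σ (ClosedBang v' V L') λ b' → (v ≡ v') × (sizeB b ≡ sizeB b')
closedBang-↭ b ↭refl = _ , closeB b , refl , sym (closeB-size b)
closedBang-↭ (bang-cons {w = w} {q = q} iu da b) (↭prep x p) with closedBang-↭ b p
... | v' , b' , refl , s = _ , closedBang-cons iu (closeA da) b' , refl , cong₂ N._+_ (sym (closeA-size da)) s
closedBang-↭ (bang-cons {w = w1} {q = q1} iu1 da1 (bang-cons {w = w2} {v = v0} {q = q2} iu2 da2 b)) (↭swap x y p)
  with closedBang-↭ b p
... | v' , b' , refl , s = _ , closedBang-cons iu2 (closeA da2) (closedBang-cons iu1 (closeA da1) b') ,
  solve 3 (λ a c x → a :+ (c :+ x) := c :+ (a :+ x)) refl (q1 * w1) (q2 * w2) v0 ,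
  trans (ℕ+.x∙yz≈y∙xz (sizeA da1) (sizeA da2) _)
    (cong₂ N._+_ (sym (closeA-size da2)) (cong₂ N._+_ (sym (closeA-size da1)) s))
closedBang-↭ b (↭trans p q) with closedBang-↭ b p
... | v1 , b1 , e1 , s1 with closedBang-↭ b1 q
... | v2 , b2 , e2 , s2 = v2 , b2 , trans e1 e2 , trans s1 s2

closedBang-unscale : ∀ {V c v} M {zs} {Γ : Ctx 0} (b : Bang Γ v V zs) →
  Pointwise _≈qA_ zs (scaleI c M) → WFInter M →
  Σ ℚ λ u → Σ Inter λ zs' → Σ (ClosedBang u V zs') λ b' →
    (c * u ≡ v) × Pointwise _≈qA_ zs' M × (sizeB b' ≡ sizeB b)
closedBang-unscale {c = c} [] bang-nil [] _ = 0ℚ , [] , bang-nil , *-zeroʳ c , [] , refl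
closedBang-unscale {c = c} ((q , A) ∷ M) (bang-cons {w = w} {v = v0} {A = A'} iu da b) ((refl , r) ∷ pw) (iq , _ , wm)
  with closedBang-unscale {c = c} M b pw wm
... | u , zs' , b' , refl , pw' , s =
  q * w + u , (q , A') ∷ zs' , closedBang-cons iq (closeA da) b' ,
  solve 4 (λ c q w u → c :* (q :* w :+ u) := c :* q :* w :+ c :* u) refl c q w u ,
  (refl , r) ∷ pw' , cong₂ N._+_ (closeA-size da) s

closedBang-scale : ∀ {V v L p} {Γ : Ctx 0} → InUnit p → Bang Γ v V L → Σ ℚ λ v' →
  ClosedBang v' V (scaleI p L) × (v' ≡ p * v)
closedBang-scale {p = p} ip bang-nil = 0ℚ , bang-nil , sym (*-zeroʳ p)
closedBang-scale {p = p} ip (bang-cons {w = w} {v = v0} {q = q} iu da b) with closedBang-scale ip b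
... | v' , b' , refl = _ , closedBang-cons (InUnit-* ip iu) (closeA da) b' ,
  solve 4 (λ p q w v → p :* q :* w :+ p :* v := p :* (q :* w :+ v)) refl p q w v0

closedBang-++ : ∀ {V v1 v2 L1 L2} {Γ Γ' : Ctx 0} → Bang Γ v1 V L1 → Bang Γ' v2 V L2 → Σ ℚ λ v →
  ClosedBang v V (L1 ++ L2) × (v ≡ v1 + v2)
closedBang-++ bang-nil b2 = _ , closeB b2 , sym (+-identityˡ _)
closedBang-++ {v2 = v2} (bang-cons {w = w} {v = v0} {q = q} iu da b) b2 with closedBang-++ b b2
... | v , b' , refl = _ , closedBang-cons iu (closeA da) b' ,
  sym (+-assoc (q * w) v0 v2)

ceq-shift : ∀ {n} (A B C : Ctx n) → CtxEq (A ⊎c (B ⊎c C)) (B ⊎c (A ⊎c C))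
ceq-shift []v []v []v = tt
ceq-shift (a ∷v A) (b ∷v B) (c ∷v C) = ↭⇒≈I (shifts a b) , ceq-shift A B C

ceq-⊎ˡ : ∀ {n} (A : Ctx n) {C C'} → CtxEq C C' → CtxEq (A ⊎c C) (A ⊎c C')
ceq-⊎ˡ A e = ceq-⊎ (ceq-refl A) e

branches-↭ : ∀ {n} {M : Term (suc n)} {zs a' Δ ws b} (br : Branches M zs Δ ws b) → zs ↭ a' →
  Σ (Ctx n) λ Δ' → Σ ℚ λ ws' → Σ TDist λ b' → Σ (Branches M a' Δ' ws' b') λ br' →
    CtxEq Δ' Δ × (ws' ≡ ws) × (b' ↭ b) × (sizeBr br' ≡ sizeBr br)
branches-↭ br ↭refl = _ , _ , _ , br , ceq-refl _ , refl , ↭refl , refl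
branches-↭ (br-cons {p = p} {Δ = Δ} {w = w} {b = b} d e br) (↭prep x q) with branches-↭ br q
... | Δ' , ws' , b' , br' , ce , refl , pb , s =
  _ , _ , _ , br-cons d e br' , ceq-⊎ˡ (p ·c Δ) ce , refl , ++⁺ˡ (scaleD p b) pb , cong (sizeT d N.+_) s
branches-↭ (br-cons {p = p1} {Δ = Δ1} {w = w1} {b = b1} d1 e1 (br-cons {p = p2} {Δ = Δ2} {Δs = Δs} {w = w2} {ws = ws} {b = b2} {bs = bs} d2 e2 br)) (↭swap x y q) with branches-↭ br q
... | Δ' , ws' , b' , br' , ce , refl , pb , s =
  _ , _ , _ , br-cons d2 e2 (br-cons d1 e1 br') ,
  ceq-trans (ceq-⊎ˡ (p2 ·c Δ2) (ceq-⊎ˡ (p1 ·c Δ1) ce)) (ceq-shift (p2 ·c Δ2) (p1 ·c Δ1) Δs) ,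
  solve 5 (λ a c x y z → a :* x :+ (c :* y :+ z) := c :* y :+ (a :* x :+ z)) refl p2 p1 w2 w1 ws ,
  ↭trans (++⁺ˡ (scaleD p2 b2) (++⁺ˡ (scaleD p1 b1) pb)) (shifts (scaleD p2 b2) (scaleD p1 b1)) ,
  trans (cong (λ z → sizeT d2 N.+ (sizeT d1 N.+ z)) s) (ℕ+.x∙yz≈y∙xz (sizeT d2) (sizeT d1) (sizeBr br))
branches-↭ br (↭trans p q) with branches-↭ br p
... | Δ1 , ws1 , b1 , br1 , ce1 , e1 , pb1 , s1 with branches-↭ br1 q
... | Δ2 , ws2 , b2 , br2 , ce2 , e2 , pb2 , s2 =
  Δ2 , ws2 , b2 , br2 , ceq-trans ce2 ce1 , trans e2 e1 , ↭trans pb2 pb1 , trans s2 s1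

branches-pointwise : ∀ {n} {M : Term (suc n)} {a zs Δ ws b} (br : Branches M a Δ ws b) → Pointwise _≈pI_ zs a →
  Σ (Branches M zs Δ ws b) λ br' → sizeBr br' ≡ sizeBr br
branches-pointwise br-nil [] = br-nil , refl
branches-pointwise (br-cons d e br) ((refl , r) ∷ pw) with branches-pointwise br pw
... | br' , s = br-cons d (≈I-trans e (≈I-sym r)) br' , cong (sizeT d N.+_) s

branches-≈D : ∀ {n} {M : Term (suc n)} {a a' Δ ws b} (br : Branches M a Δ ws b) → a' ≈D a →
  Σ (Ctx n) λ Δ' → Σ ℚ λ ws' → Σ TDist λ b' → Σ (Branches M a' Δ' ws' b') λ br' →
    CtxEq Δ' Δ × (ws' ≡ ws) × (b' ≈D b) × (sizeBr br' ≡ sizeBr br)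
branches-≈D br (dist≈ p) with PermI.toNF p
... | zs , q , pw with branches-pointwise br pw
... | br1 , s1 with branches-↭ br1 (↭-sym q)
... | Δ' , ws' , b' , br' , ce , e , pb , s = Δ' , ws' , b' , br' , ce , e , ↭⇒≈D pb , trans s s1

record ScaledSplit (V0 : Val 0) (c v : ℚ) (zs L1 L2 : Inter) (s : ℕ) : Set where
  constructor scaledSplit
  field
    zs1 zs2 : Inter
    v1 v2 : ℚ
    b1 : ClosedBang v1 V0 zs1
    b2 : ClosedBang v2 V0 zs2
    pw1 : Pointwise _≈qA_ zs1 (scaleI c L1)
    pw2 : Pointwise _≈qA_ zs2 (scaleI c L2)
    ve : v ≡ v1 + v2
    se : s ≡ sizeB b1 N.+ sizeB b2

closedBang-split-scaled : ∀ {V0 c v zs} L1 L2 (b : ClosedBang v V0 zs) →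
  Pointwise _≈qA_ zs (scaleI c (L1 ++ L2)) → ScaledSplit V0 c v zs L1 L2 (sizeB b)
closedBang-split-scaled {c = c} L1 L2 b pw with PermA.pointwise-++-split (scaleI c L1) (scaleI c L2)
  (subst (Pointwise _≈qA_ _) (scaleI-++ c L1 L2) pw)
... | zs1 , zs2 , refl , p1 , p2 with closedBang-split zs1 zs2 b
... | v1 , v2 , b1 , b2 , e , s = scaledSplit zs1 zs2 v1 v2 b1 b2 p1 p2 e s

closedBang-[]-scaled : ∀ {V0 c v zs} (b : ClosedBang v V0 zs) → Pointwise _≈qA_ zs (scaleI c []) →
  (v ≡ 0ℚ) × (sizeB b ≡ 0)
closedBang-[]-scaled bang-nil [] = refl , refl

pointwise-scaleI-cong : ∀ {zs} c {L L'} → L ≡ L' → Pointwise _≈qA_ zs (scaleI c L) →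
  Pointwise _≈qA_ zs (scaleI c L')
pointwise-scaleI-cong {zs} c e pw = subst (λ L → Pointwise _≈qA_ zs (scaleI c L)) e pw

pointwise-scaleI-* : ∀ {zs} c q L → Pointwise _≈qA_ zs (scaleI c (scaleI q L)) →
  Pointwise _≈qA_ zs (scaleI (c * q) L)
pointwise-scaleI-* {zs} c q L pw = subst (Pointwise _≈qA_ zs) (scaleI-* c q L) pw

≈I-singleton-inv : ∀ {Mo q A} → Mo ≈I ((q , A) ∷ []) → Σ Arrow λ A' → (Mo ≡ (q , A') ∷ []) × A' ≈A A
≈I-singleton-inv (inter≈ p) with PermA.toNF p
... | ((q' , A') ∷ []) , pr , ((refl , r) ∷ []) = A' , ↭-singleton-inv pr , r

-- Substitution

module _ (V0 : Val 0) where

  -- V0 replaces the last variable. The closed (!)-derivation of V0 carries the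
  -- types of all occurrences of that variable scaled by c, the product of the
  -- probabilities and scale factors above the current subderivation; the part u
  -- of its weight that the subderivation absorbs satisfies c * u = v. The size of
  -- the result is at most the sum of both sizes, which makes a β-step shrink the
  -- derivation.
  record SubstT (d : ℕ) (σ : Fin (d N.+ 1) → Val d) (Γ : Ctx (d N.+ 1))
      (w : ℚ) (M : Term (d N.+ 1)) (a : TDist) (c v : ℚ) (s : ℕ) : Set where
    constructor resT
    field
      Γ' : Ctx d
      w' : ℚ
      a' : TDist
      D' : DerT Γ' w' (subT σ M) a'
      ceq : CtxEq Γ' (initC d Γ)
      aeq : a' ≈D a
      u : ℚ
      cu : c * u ≡ v
      wu : w' ≡ w + u
      sz : sizeT D' N.≤ s

  record SubstI (d : ℕ) (σ : Fin (d N.+ 1) → Val d) (Γ : Ctx (d N.+ 1))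
      (w : ℚ) (V : Val (d N.+ 1)) (Mo : Inter) (c v : ℚ) (s : ℕ) : Set where
    constructor resI
    field
      Γ' : Ctx d
      w' : ℚ
      Mo' : Inter
      D' : DerI Γ' w' (subV σ V) Mo'
      ceq : CtxEq Γ' (initC d Γ)
      meq : Mo' ≈I Mo
      u : ℚ
      cu : c * u ≡ v
      wu : w' ≡ w + u
      sz : sizeI D' N.≤ s

  record SubstB (d : ℕ) (σ : Fin (d N.+ 1) → Val d) (Γ : Ctx (d N.+ 1))
      (w : ℚ) (V : Val (d N.+ 1)) (Mo : Inter) (c v : ℚ) (s : ℕ) : Set where
    constructor resB
    field
      Γ' : Ctx d
      w' : ℚ
      Mo' : Inter
      D' : Bang Γ' w' (subV σ V) Mo'
      ceq : CtxEq Γ' (initC d Γ)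
      meq : Pointwise _≈qA_ Mo' Mo
      u : ℚ
      cu : c * u ≡ v
      wu : w' ≡ w + u
      sz : sizeB D' N.≤ s

  record SubstA (d : ℕ) (σ : Fin (d N.+ 1) → Val d) (Γ : Ctx (d N.+ 1))
      (w : ℚ) (V : Val (d N.+ 1)) (A : Arrow) (c v : ℚ) (s : ℕ) : Set where
    constructor resA
    field
      Γ' : Ctx d
      w' : ℚ
      A' : Arrow
      D' : DerA Γ' w' (subV σ V) A'
      ceq : CtxEq Γ' (initC d Γ)
      aeq : A' ≈A A
      u : ℚ
      cu : c * u ≡ v
      wu : w' ≡ w + u
      sz : sizeA D' N.≤ s

  record SubstBr (d : ℕ) (σ : Fin (d N.+ 1) → Val d) (M : Term (suc (d N.+ 1)))
      (a : TDist) (Δ : Ctx (d N.+ 1)) (ws : ℚ) (b : TDist) (c v : ℚ) (s : ℕ) : Set where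
    constructor resBr
    field
      Δ' : Ctx d
      ws' : ℚ
      b' : TDist
      D' : Branches (subT (exts σ) M) a Δ' ws' b'
      ceq : CtxEq Δ' (initC d Δ)
      beq : b' ≈D b
      u : ℚ
      cu : c * u ≡ v
      wu : ws' ≡ ws + u
      sz : sizeBr D' N.≤ s

  mutual
    substitutionT : ∀ {d σ} → SubstLast V0 d σ → ∀ {Γ w M a} (D : DerT Γ w M a) →
      ∀ {c v zs} (b : ClosedBang v V0 zs) → Pointwise _≈qA_ zs (scaleI c (lastC d Γ)) →
      SubstT d σ Γ w M a c v (sizeT D N.+ sizeB b)
    substitutionT {d} s zero-rule {c = c} b pw with closedBang-[]-scaled {c = c} b
      (pointwise-scaleI-cong c (lastC-∅ d) pw)
    ... | refl , e = resT ∅ 0ℚ [] zero-rule (ceq-≡ (sym (initC-∅ d))) (≈D-refl []) 0ℚ (*-zeroʳ c)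
                       (sym (+-identityˡ 0ℚ)) z≤n
    substitutionT {d} s (val-rule D) {c = c} b pw with substitutionI s D {c = c} b pw
    ... | resI Γ' w' Mo' D' ce me u cu wu sz =
      resT Γ' w' _ (val-rule D') ce (dist≈ (prefl ((refl , me) ∷ []))) u cu wu (s≤s sz)
    substitutionT {d} s (app-rule {Γ = Γ} {Δ} {w} {v} {M = Md} {M' = M'} {b = bt} dv dw eq) {c = c} b pw
      with closedBang-split-scaled {c = c} (lastC d Γ) (lastC d Δ) b (pointwise-scaleI-cong c (lastC-⊎ d Γ Δ) pw)
    ... | scaledSplit zs1 zs2 v1 v2 b1 b2 pw1 pw2 refl se with substitutionI s dv {c = c} b1 pw1 | substitutionI s dw {c = c} b2 pw2
    ... | resI Γ1 w1 Mo1 D1 ce1 me1 u1 refl refl sz1 | resI Γ2 w2 Mo2 D2 ce2 me2 u2 refl refl sz2 with ≈I-singleton-inv me1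
    ... | (N' ⇒ b') , refl , arr≈ nr br =
      resT (Γ1 ⊎c Γ2) _ b' (app-rule D1 D2 (≈I-trans me2 (≈I-trans eq (≈I-sym nr))))
         (ceq-trans (ceq-⊎ ce1 ce2) (ceq-≡ (sym (initC-⊎ d Γ Δ)))) br (u1 + u2)
         (solve 3 (λ c x y → c :* (x :+ y) := c :* x :+ c :* y) refl c u1 u2)
         (solve 4 (λ a b x y → (a :+ x) :+ (b :+ y) := (a :+ b) :+ (x :+ y)) refl w v u1 u2)
         (s≤s (≤-+-interchange (sizeI dv) (sizeI dw) (sizeB b1) (sizeB b2) sz1 sz2 se))
    substitutionT {d} s (⊕-rule {Γ = Γ} {Δ} {w} {v} d1 d2) {c = c} b pw
      with closedBang-split-scaled {c = c} (scaleI ½ (lastC d Γ)) (scaleI ½ (lastC d Δ)) b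
             (pointwise-scaleI-cong c (trans (lastC-⊎ d (½ ·c Γ) (½ ·c Δ)) (cong₂ _++_ (lastC-· d ½ Γ) (lastC-· d ½ Δ))) pw)
    ... | scaledSplit zs1 zs2 v1 v2 b1 b2 pw1 pw2 refl se
      with substitutionT s d1 {c = c * ½} b1 (pointwise-scaleI-* c ½ _ pw1) | substitutionT s d2 {c = c * ½} b2 (pointwise-scaleI-* c ½ _ pw2)
    ... | resT Γ1 w1 a1 D1 ce1 ae1 u1 refl refl sz1 | resT Γ2 w2 a2 D2 ce2 ae2 u2 refl refl sz2 =
      resT _ _ _ (⊕-rule D1 D2)
         (ceq-trans (ceq-⊎ (ceq-· ½ ce1) (ceq-· ½ ce2))
           (ceq-≡ (sym (trans (initC-⊎ d (½ ·c Γ) (½ ·c Δ)) (cong₂ _⊎c_ (initC-· d ½ Γ) (initC-· d ½ Δ))))))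
         (≈D-++ (≈D-scale ½ ae1) (≈D-scale ½ ae2)) (½ * u1 + ½ * u2)
         (solve 3 (λ c x y → c :* (con ½ :* x :+ con ½ :* y) := c :* con ½ :* x :+ c :* con ½ :* y) refl c u1 u2)
         (solve 4 (λ a b x y → con ½ :* (a :+ x) :+ con ½ :* (b :+ y) :+ con 1ℚ := (con ½ :* a :+ con ½ :* b :+ con 1ℚ) :+ (con ½ :* x :+ con ½ :* y)) refl w v u1 u2)
         (s≤s (≤-+-interchange (sizeT d1) (sizeT d2) (sizeB b1) (sizeB b2) sz1 sz2 se))
    substitutionT {d} s (let-rule {Γ = Γ} {Δ} {v} {ws} dn br) {c = c} b pw
      with closedBang-split-scaled {c = c} (lastC d Γ) (lastC d Δ) b (pointwise-scaleI-cong c (lastC-⊎ d Γ Δ) pw)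
    ... | scaledSplit zs1 zs2 v1 v2 b1 b2 pw1 pw2 refl se with substitutionT s dn {c = c} b1 pw1 | substitutionBr s br {c = c} b2 pw2
    ... | resT Γ1 w1 a1 D1 ce1 ae1 u1 refl refl sz1 | resBr Δ2 ws2 b2' Br2 ce2 be2 u2 refl refl sz2
      with branches-≈D Br2 ae1
    ... | Δ3 , ws3 , b3 , Br3 , ce3 , refl , be3 , s3 =
      resT _ _ _ (let-rule D1 Br3)
         (ceq-trans (ceq-⊎ ce1 (ceq-trans ce3 ce2)) (ceq-≡ (sym (initC-⊎ d Γ Δ))))
         (≈D-trans be3 be2) (u2 + u1)
         (solve 3 (λ c x y → c :* (x :+ y) := c :* y :+ c :* x) refl c u2 u1)
         (solve 4 (λ a b x y → (a :+ x) :+ (b :+ y) :+ con 1ℚ := (a :+ b :+ con 1ℚ) :+ (x :+ y)) refl ws v u2 u1)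
         (s≤s (NP.≤-trans (NP.≤-reflexive (cong (sizeT D1 N.+_) s3))
                (NP.≤-trans (NP.≤-reflexive (NP.+-comm (sizeT D1) (sizeBr Br2)))
                  (NP.≤-trans (≤-+-interchange (sizeBr br) (sizeT dn) (sizeB b2) (sizeB b1) sz2 sz1 (trans se (NP.+-comm (sizeB b1) (sizeB b2))))
                     (NP.≤-reflexive (cong (N._+ sizeB b) (NP.+-comm (sizeBr br) (sizeT dn))))))))

    substitutionI : ∀ {d σ} → SubstLast V0 d σ → ∀ {Γ w V Mo} (D : DerI Γ w V Mo) →
      ∀ {c v zs} (b : ClosedBang v V0 zs) → Pointwise _≈qA_ zs (scaleI c (lastC d Γ)) →
      SubstI d σ Γ w V Mo c v (sizeI D N.+ sizeB b)
    substitutionI {d} s (var-rule {x = x} {M = Mo} h) {c = c} b pw with lastVarView d x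
    ... | inner j with closedBang-[]-scaled {c = c} b (pointwise-scaleI-cong c (lastC-inj d j Mo) pw)
    ... | refl , e = resI (single j Mo) 0ℚ Mo (castValI (sym (substLast-inner s j)) (var-rule h))
                       (ceq-≡ (sym (initC-inj d j Mo))) (≈I-refl Mo) 0ℚ (*-zeroʳ c) (sym (+-identityˡ 0ℚ))
                       (NP.≤-reflexive (trans (castValI-size (sym (substLast-inner s j)) (var-rule h)) (sym e)))
    substitutionI {d} s (var-rule {x = x} {M = Mo} h) {c = c} b pw | last with closedBang-unscale {c = c} Mo b (pointwise-scaleI-cong c (lastC-last d Mo) pw) h
    ... | u , zs' , b' , cu , pw' , sb =
      resI ∅ u zs' (castValI (sym (substLast-last s)) (!-rule (weakenB {ρ = noVars {d}} (λ ()) b')))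
         (ceq-≡ (sym (initC-last d Mo))) (inter≈ (prefl pw')) u cu (sym (+-identityˡ u))
         (NP.≤-reflexive (trans (castValI-size (sym (substLast-last s)) (!-rule (weakenB {ρ = noVars {d}} (λ ()) b')))
            (trans (weakenB-size {ρ = noVars {d}} (λ ()) b') sb)))
    substitutionI s (!-rule B) {c = c} b pw with substitutionB s B {c = c} b pw
    ... | resB Γ' w' Mo' D' ce me u cu wu sz = resI Γ' w' Mo' (!-rule D') ce (inter≈ (prefl me)) u cu wu sz

    substitutionB : ∀ {d σ} → SubstLast V0 d σ → ∀ {Γ w V Mo} (D : Bang Γ w V Mo) →
      ∀ {c v zs} (b : ClosedBang v V0 zs) → Pointwise _≈qA_ zs (scaleI c (lastC d Γ)) →
      SubstB d σ Γ w V Mo c v (sizeB D N.+ sizeB b)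
    substitutionB {d} s bang-nil {c = c} b pw with closedBang-[]-scaled {c = c} b
      (pointwise-scaleI-cong c (lastC-∅ d) pw)
    ... | refl , e = resB ∅ 0ℚ [] bang-nil (ceq-≡ (sym (initC-∅ d))) [] 0ℚ (*-zeroʳ c) (sym (+-identityˡ 0ℚ)) z≤n
    substitutionB {d} s (bang-cons {Γ = Γ} {Δ} {w} {v} {q = q} iu da B) {c = c} b pw
      with closedBang-split-scaled {c = c} (scaleI q (lastC d Γ)) (lastC d Δ) b
             (pointwise-scaleI-cong c (trans (lastC-⊎ d (q ·c Γ) Δ) (cong (_++ lastC d Δ) (lastC-· d q Γ))) pw)
    ... | scaledSplit zs1 zs2 v1 v2 b1 b2 pw1 pw2 refl se
      with substitutionA s da {c = c * q} b1 (pointwise-scaleI-* c q _ pw1) | substitutionB s B {c = c} b2 pw2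
    ... | resA Γ1 w1 A1 D1 ce1 ae1 u1 refl refl sz1 | resB Γ2 w2 M2 D2 ce2 me2 u2 refl refl sz2 =
      resB _ _ _ (bang-cons iu D1 D2)
         (ceq-trans (ceq-⊎ (ceq-· q ce1) ce2)
           (ceq-≡ (sym (trans (initC-⊎ d (q ·c Γ) Δ) (cong (_⊎c initC d Δ) (initC-· d q Γ))))))
         ((refl , ae1) ∷ me2) (q * u1 + u2)
         (solve 4 (λ c q x y → c :* (q :* x :+ y) := c :* q :* x :+ c :* y) refl c q u1 u2)
         (solve 5 (λ q a b x y → q :* (a :+ x) :+ (b :+ y) := (q :* a :+ b) :+ (q :* x :+ y)) refl q w v u1 u2)
         (≤-+-interchange (sizeA da) (sizeB B) (sizeB b1) (sizeB b2) sz1 sz2 se)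

    substitutionA : ∀ {d σ} → SubstLast V0 d σ → ∀ {Γ w V A} (D : DerA Γ w V A) →
      ∀ {c v zs} (b : ClosedBang v V0 zs) → Pointwise _≈qA_ zs (scaleI c (lastC d Γ)) →
      SubstA d σ Γ w V A c v (sizeA D N.+ sizeB b)
    substitutionA {d} s (λ-rule {w = w} D) {c = c} b pw with substitutionT (substLast-exts s) D {c = c} b pw
    ... | resT (Mx' ∷v Γ') w' b' D' (mx , ce) be u cu refl sz =
      resA Γ' _ (Mx' ⇒ b') (λ-rule D') ce (arr≈ mx be) u cu
         (solve 2 (λ w u → (w :+ u) :+ con 1ℚ := (w :+ con 1ℚ) :+ u) refl w u) (s≤s sz)

    substitutionBr : ∀ {d σ} → SubstLast V0 d σ → ∀ {M a Δ ws bt} (D : Branches M a Δ ws bt) →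
      ∀ {c v zs} (b : ClosedBang v V0 zs) → Pointwise _≈qA_ zs (scaleI c (lastC d Δ)) →
      SubstBr d σ M a Δ ws bt c v (sizeBr D N.+ sizeB b)
    substitutionBr {d} s br-nil {c = c} b pw with closedBang-[]-scaled {c = c} b
      (pointwise-scaleI-cong c (lastC-∅ d) pw)
    ... | refl , e = resBr ∅ 0ℚ [] br-nil (ceq-≡ (sym (initC-∅ d))) (≈D-refl []) 0ℚ (*-zeroʳ c)
      (sym (+-identityˡ 0ℚ)) z≤n
    substitutionBr {d} s (br-cons {p = p} {Δ = Δ} {Δs = Δs} {w = w} {ws = ws} D e br) {c = c} b pw
      with closedBang-split-scaled {c = c} (scaleI p (lastC d Δ)) (lastC d Δs) b
             (pointwise-scaleI-cong c (trans (lastC-⊎ d (p ·c Δ) Δs) (cong (_++ lastC d Δs) (lastC-· d p Δ))) pw)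
    ... | scaledSplit zs1 zs2 v1 v2 b1 b2 pw1 pw2 refl se
      with substitutionT (substLast-exts s) D {c = c * p} b1 (pointwise-scaleI-* c p _ pw1)
         | substitutionBr s br {c = c} b2 pw2
    ... | resT (Mx' ∷v Γ1) w1 b1' D1 (mx , ce1) be1 u1 refl refl sz1 | resBr Δ2 ws2 b2' D2 ce2 be2 u2 refl refl sz2 =
      resBr _ _ _ (br-cons D1 (≈I-trans mx e) D2)
         (ceq-trans (ceq-⊎ (ceq-· p ce1) ce2)
           (ceq-≡ (sym (trans (initC-⊎ d (p ·c Δ) Δs) (cong (_⊎c initC d Δs) (initC-· d p Δ))))))
         (≈D-++ (≈D-scale p be1) be2) (p * u1 + u2)
         (solve 4 (λ c q x y → c :* (q :* x :+ y) := c :* q :* x :+ c :* y) refl c p u1 u2)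
         (solve 5 (λ q a b x y → q :* (a :+ x) :+ (b :+ y) := (q :* a :+ b) :+ (q :* x :+ y)) refl p w ws u1 u2)
         (≤-+-interchange (sizeT D) (sizeBr br) (sizeB b1) (sizeB b2) sz1 sz2 se)

-- Anti-substitution

module _ (V0 : Val 0) where

  record AntiSubstT (d : ℕ) (Γ : Ctx d) (w : ℚ) (M : Term (d N.+ 1)) (a : TDist) : Set where
    constructor antiResT
    field
      G : Ctx (d N.+ 1)
      w1 w2 : ℚ
      L : Inter
      bg : ClosedBang w2 V0 L
      D' : DerT G w1 M a
      ie : initC d G ≡ Γ
      le : lastC d G ≡ L
      we : w ≡ w1 + w2

  record AntiSubstI (d : ℕ) (Γ : Ctx d) (w : ℚ) (V : Val (d N.+ 1)) (Mo : Inter) : Set where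
    constructor antiResI
    field
      G : Ctx (d N.+ 1)
      w1 w2 : ℚ
      L : Inter
      bg : ClosedBang w2 V0 L
      D' : DerI G w1 V Mo
      ie : initC d G ≡ Γ
      le : lastC d G ≡ L
      we : w ≡ w1 + w2

  record AntiSubstB (d : ℕ) (Γ : Ctx d) (w : ℚ) (V : Val (d N.+ 1)) (Mo : Inter) : Set where
    constructor antiResB
    field
      G : Ctx (d N.+ 1)
      w1 w2 : ℚ
      L : Inter
      bg : ClosedBang w2 V0 L
      D' : Bang G w1 V Mo
      ie : initC d G ≡ Γ
      le : lastC d G ≡ L
      we : w ≡ w1 + w2

  record AntiSubstA (d : ℕ) (Γ : Ctx d) (w : ℚ) (V : Val (d N.+ 1)) (A : Arrow) : Set where
    constructor antiResA
    field
      G : Ctx (d N.+ 1)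
      w1 w2 : ℚ
      L : Inter
      bg : ClosedBang w2 V0 L
      D' : DerA G w1 V A
      ie : initC d G ≡ Γ
      le : lastC d G ≡ L
      we : w ≡ w1 + w2

  record AntiSubstBr (d : ℕ) (M : Term (suc (d N.+ 1))) (a : TDist) (Δ : Ctx d) (ws : ℚ) (b : TDist) : Set where
    constructor antiResBr
    field
      G : Ctx (d N.+ 1)
      w1 w2 : ℚ
      L : Inter
      bg : ClosedBang w2 V0 L
      D' : Branches M a G w1 b
      ie : initC d G ≡ Δ
      le : lastC d G ≡ L
      we : ws ≡ w1 + w2

  mutual
    antiSubstitutionT : ∀ {d σ} → SubstLast V0 d σ → ∀ (M : Term (d N.+ 1)) {Γ w a} → DerT Γ w (subT σ M) a →
      AntiSubstT d Γ w M a
    antiSubstitutionT {d} s (val _) zero-rule = antiResT ∅ 0ℚ 0ℚ [] bang-nil zero-rule (initC-∅ d) (lastC-∅ d) refl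
    antiSubstitutionT {d} s (app _ _) zero-rule = antiResT ∅ 0ℚ 0ℚ [] bang-nil zero-rule (initC-∅ d) (lastC-∅ d) refl
    antiSubstitutionT {d} s (_ ⊕ _) zero-rule = antiResT ∅ 0ℚ 0ℚ [] bang-nil zero-rule (initC-∅ d) (lastC-∅ d) refl
    antiSubstitutionT {d} s (let' _ _) zero-rule = antiResT ∅ 0ℚ 0ℚ [] bang-nil zero-rule (initC-∅ d) (lastC-∅ d) refl
    antiSubstitutionT {d} s (val V) (val-rule DI) with antiSubstitutionI s V DI
    ... | antiResI G w1 w2 L bg D' ie le we = antiResT G w1 w2 L bg (val-rule D') ie le we
    antiSubstitutionT {d} s (app V W) (app-rule dv dw eq) with antiSubstitutionI s V dv | antiSubstitutionI s W dw
    ... | antiResI G1 a1 a2 L1 bg1 D1 refl refl refl | antiResI G2 b1 b2 L2 bg2 D2 refl refl refl with closedBang-++ bg1 bg2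
    ... | v , bg , refl =
      antiResT (G1 ⊎c G2) _ _ _ bg (app-rule D1 D2 eq) (initC-⊎ d G1 G2) (lastC-⊎ d G1 G2)
        (solve 4 (λ a b x y → (a :+ x) :+ (b :+ y) := (a :+ b) :+ (x :+ y)) refl a1 b1 a2 b2)
    antiSubstitutionT {d} s (M ⊕ N) (⊕-rule d1 d2) with antiSubstitutionT s M d1 | antiSubstitutionT s N d2
    ... | antiResT G1 a1 a2 L1 bg1 D1 refl refl refl | antiResT G2 b1 b2 L2 bg2 D2 refl refl refl
      with closedBang-scale InUnit-½ bg1 | closedBang-scale InUnit-½ bg2
    ... | x1 , c1 , refl | x2 , c2 , refl with closedBang-++ c1 c2
    ... | v , bg , refl =
      antiResT (⊕-ctx G1 G2) _ _ _ bg (⊕-rule D1 D2)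
        (trans (initC-⊎ d (½ ·c G1) (½ ·c G2)) (cong₂ _⊎c_ (initC-· d ½ G1) (initC-· d ½ G2)))
        (trans (lastC-⊎ d (½ ·c G1) (½ ·c G2)) (cong₂ _++_ (lastC-· d ½ G1) (lastC-· d ½ G2)))
        (solve 4 (λ a b x y → con ½ :* (a :+ x) :+ con ½ :* (b :+ y) :+ con 1ℚ := (con ½ :* a :+ con ½ :* b :+ con 1ℚ) :+ (con ½ :* x :+ con ½ :* y)) refl a1 b1 a2 b2)
    antiSubstitutionT {d} s (let' N M) (let-rule dn br) with antiSubstitutionT s N dn | antiSubstitutionBr s M br (proj₁ (proj₂ (derT-wf dn)))
    ... | antiResT G1 a1 a2 L1 bg1 D1 refl refl refl | antiResBr G2 b1 b2 L2 bg2 D2 refl refl refl with closedBang-++ bg1 bg2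
    ... | v , bg , refl =
      antiResT (G1 ⊎c G2) _ _ _ bg (let-rule D1 D2) (initC-⊎ d G1 G2) (lastC-⊎ d G1 G2)
        (solve 4 (λ a b x y → (b :+ y) :+ (a :+ x) :+ con 1ℚ := (b :+ a :+ con 1ℚ) :+ (x :+ y)) refl a1 b1 a2 b2)

    antiSubstitutionI : ∀ {d σ} → SubstLast V0 d σ → ∀ (V : Val (d N.+ 1)) {Γ w Mo} → DerI Γ w (subV σ V) Mo →
      AntiSubstI d Γ w V Mo
    antiSubstitutionI {d} s (var i) DI with lastVarView d i
    ... | inner j = antiSubstitution-inner j (subst (λ X → DerI _ _ X _) (substLast-inner s j) DI)
    ... | last = antiSubstitution-last (subst (λ X → DerI _ _ X _) (substLast-last s) DI)
    antiSubstitutionI {d} s (lam B) (!-rule Bg) with antiSubstitutionB s B Bg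
    ... | antiResB G w1 w2 L bg D' ie le we = antiResI G w1 w2 L bg (!-rule D') ie le we

    antiSubstitution-inner : ∀ {d} (j : Fin d) {Γ w Mo} → DerI Γ w (var j) Mo → AntiSubstI d Γ w (var (j ↑ˡ 1)) Mo
    antiSubstitution-inner {d} j (var-rule {M = Mo} h) = antiResI (single (j ↑ˡ 1) Mo) 0ℚ 0ℚ [] bang-nil
      (var-rule h) (initC-inj d j Mo) (lastC-inj d j Mo) refl
    antiSubstitution-inner {d} j (!-rule bang-nil) = antiResI ∅ 0ℚ 0ℚ [] bang-nil (!-rule bang-nil)
      (initC-∅ d) (lastC-∅ d) refl

    antiSubstitution-last : ∀ {d} {Γ w Mo} → DerI Γ w (weakenClosed d V0) Mo →
      AntiSubstI d Γ w (var (lastVar d)) Mo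
    antiSubstitution-last {d} {Mo = Mo} DI with unweakenI {ρ = noVars {d}} (λ ()) V0 DI
    ... | []v , refl , DI0 =
      antiResI (single (lastVar d) Mo) 0ℚ _ Mo (closedDerI⇒bang DI0) (var-rule (proj₂ (derI-wf DI0)))
        (initC-last d Mo) (lastC-last d Mo)
          (sym (+-identityˡ _))

    antiSubstitutionB : ∀ {d σ} → SubstLast V0 d σ → ∀ (B : Term (suc d N.+ 1)) {Γ w Mo} →
      Bang Γ w (lam (subT (exts σ) B)) Mo → AntiSubstB d Γ w (lam B) Mo
    antiSubstitutionB {d} s B bang-nil = antiResB ∅ 0ℚ 0ℚ [] bang-nil bang-nil (initC-∅ d) (lastC-∅ d) refl
    antiSubstitutionB {d} s B (bang-cons {q = q} iu da b) with antiSubstitutionA s B da | antiSubstitutionB s B b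
    ... | antiResA G1 a1 a2 L1 bg1 D1 refl refl refl | antiResB G2 b1 b2 L2 bg2 D2 refl refl refl with closedBang-scale iu bg1
    ... | x1 , c1 , refl with closedBang-++ c1 bg2
    ... | v , bg , refl =
      antiResB ((q ·c G1) ⊎c G2) _ _ _ bg (bang-cons iu D1 D2)
        (trans (initC-⊎ d (q ·c G1) G2) (cong (_⊎c _) (initC-· d q G1)))
        (trans (lastC-⊎ d (q ·c G1) G2) (cong (_++ _) (lastC-· d q G1)))
        (solve 5 (λ q a b x y → q :* (a :+ x) :+ (b :+ y) := (q :* a :+ b) :+ (q :* x :+ y)) refl q a1 b1 a2 b2)

    antiSubstitutionA : ∀ {d σ} → SubstLast V0 d σ → ∀ (B : Term (suc d N.+ 1)) {Γ w A} →
      DerA Γ w (lam (subT (exts σ) B)) A → AntiSubstA d Γ w (lam B) A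
    antiSubstitutionA {d} s B (λ-rule D) with antiSubstitutionT (substLast-exts s) B D
    ... | antiResT (x ∷v G) w1 w2 L bg D' refl refl refl =
      antiResA G (w1 + 1ℚ) w2 _ bg (λ-rule D') refl refl
        (solve 2 (λ a b → (a :+ b) :+ con 1ℚ := (a :+ con 1ℚ) :+ b) refl w1 w2)

    antiSubstitutionBr : ∀ {d σ} → SubstLast V0 d σ → ∀ (M : Term (suc d N.+ 1)) {a Δ ws b} →
      Branches (subT (exts σ) M) a Δ ws b →
      WFDist' a → AntiSubstBr d M a Δ ws b
    antiSubstitutionBr {d} s M br-nil _ = antiResBr ∅ 0ℚ 0ℚ [] bang-nil br-nil (initC-∅ d) (lastC-∅ d) refl
    antiSubstitutionBr {d} s M (br-cons {p = p} D e br) (ip , _ , wa)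
      with antiSubstitutionT (substLast-exts s) M D | antiSubstitutionBr s M br wa
    ... | antiResT (x ∷v G1) a1 a2 L1 bg1 D1 refl refl refl | antiResBr G2 b1 b2 L2 bg2 D2 refl refl refl with closedBang-scale ip bg1
    ... | x1 , c1 , refl with closedBang-++ c1 bg2
    ... | v , bg , refl =
      antiResBr ((p ·c G1) ⊎c G2) _ _ _ bg (br-cons D1 e D2)
        (trans (initC-⊎ d (p ·c G1) G2) (cong (_⊎c _) (initC-· d p G1)))
        (trans (lastC-⊎ d (p ·c G1) G2) (cong (_++ _) (lastC-· d p G1)))
        (solve 5 (λ q a b x y → q :* (a :+ x) :+ (b :+ y) := (q :* a :+ b) :+ (q :* x :+ y)) refl p a1 b1 a2 b2)

mass : MDist → ℚ
mass [] = 0ℚ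
mass ((p , N) ∷ m) = p + mass m

NonNeg : MDist → Set
NonNeg = All (λ pN → 0ℚ ≤ proj₁ pN)

dirac : Term 0 → MDist
dirac M = (1ℚ , M) ∷ []

inLet : Term 1 → (ℚ × Term 0) → (ℚ × Term 0)
inLet M pN = proj₁ pN , let' (proj₂ pN) M

mass-map-inLet : ∀ M L → mass (map (inLet M) L) ≡ mass L
mass-map-inLet M [] = refl
mass-map-inLet M ((p , N) ∷ L) = cong (p +_) (mass-map-inLet M L)

mass-stepT : ∀ N → mass (stepT N) ≡ 1ℚ
mass-stepT (val V) = refl
mass-stepT (app (lam M) V) = refl
mass-stepT (M ⊕ N) = refl
mass-stepT (let' (val V) M) = refl
mass-stepT (let' (app V W) M) = trans (mass-map-inLet M (stepT (app V W))) (mass-stepT (app V W))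
mass-stepT (let' (N ⊕ N') M) = trans (mass-map-inLet M (stepT (N ⊕ N'))) (mass-stepT (N ⊕ N'))
mass-stepT (let' (let' N K) M) = trans (mass-map-inLet M (stepT (let' N K))) (mass-stepT (let' N K))

nonneg-map-inLet : ∀ M L → NonNeg L → NonNeg (map (inLet M) L)
nonneg-map-inLet M [] [] = []
nonneg-map-inLet M (x ∷ L) (h ∷ hs) = h ∷ nonneg-map-inLet M L hs

0≤½ : 0ℚ ≤ ½
0≤½ = <⇒≤ (proj₁ InUnit-½)

stepT-nonneg : ∀ (N : Term 0) → NonNeg (stepT N)
stepT-nonneg (val V) = 0≤1 ∷ []
stepT-nonneg (app (lam M) V) = 0≤1 ∷ []
stepT-nonneg (M ⊕ N) = 0≤½ ∷ 0≤½ ∷ []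
stepT-nonneg (let' (val V) M) = 0≤1 ∷ []
stepT-nonneg (let' (app V W) M) = nonneg-map-inLet M _ (stepT-nonneg (app V W))
stepT-nonneg (let' (N ⊕ N') M) = nonneg-map-inLet M _ (stepT-nonneg (N ⊕ N'))
stepT-nonneg (let' (let' N K) M) = nonneg-map-inLet M _ (stepT-nonneg (let' N K))

nonValueMass : MDist → ℚ
nonValueMass [] = 0ℚ
nonValueMass ((p , N) ∷ m) = (if isValue N then 0ℚ else p) + nonValueMass m

mass≡value+nonValue : ∀ m → mass m ≡ valueMass m + nonValueMass m
mass≡value+nonValue [] = refl
mass≡value+nonValue ((p , N) ∷ m) with isValue N
... | true = trans (cong (p +_) (mass≡value+nonValue m))
  (solve 3 (λ p x y → p :+ (x :+ y) := (p :+ x) :+ (con 0ℚ :+ y)) refl p (valueMass m) (nonValueMass m))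
... | false = trans (cong (p +_) (mass≡value+nonValue m))
  (solve 3 (λ p x y → p :+ (x :+ y) := (con 0ℚ :+ x) :+ (p :+ y)) refl p (valueMass m) (nonValueMass m))

mass-++ : ∀ L1 L2 → mass (L1 ++ L2) ≡ mass L1 + mass L2
mass-++ [] L2 = sym (+-identityˡ _)
mass-++ ((p , N) ∷ L1) L2 = trans (cong (p +_) (mass-++ L1 L2)) (sym (+-assoc p (mass L1) (mass L2)))

mass-scale : ∀ p L → mass (scaleM p L) ≡ p * mass L
mass-scale p [] = sym (*-zeroʳ p)
mass-scale p ((q , N) ∷ L) = trans (cong (p * q +_) (mass-scale p L)) (sym (*-distribˡ-+ p q (mass L)))

mass-lift : ∀ m → mass (liftStep m) ≡ mass m
mass-lift [] = refl
mass-lift ((p , N) ∷ m) = trans (mass-++ (scaleM p (stepT N)) (liftStep m))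
  (cong₂ _+_ (trans (mass-scale p (stepT N)) (trans (cong (p *_) (mass-stepT N)) (*-identityʳ p))) (mass-lift m))

nonneg-scale : ∀ p L → 0ℚ ≤ p → NonNeg L → NonNeg (scaleM p L)
nonneg-scale p [] h [] = []
nonneg-scale p (x ∷ L) h (h' ∷ hs) = *-nonneg h h' ∷ nonneg-scale p L h hs

nonneg-lift : ∀ m → NonNeg m → NonNeg (liftStep m)
nonneg-lift [] [] = []
nonneg-lift ((p , N) ∷ m) (h ∷ hs) = AllP.++⁺ (nonneg-scale p (stepT N) h (stepT-nonneg N)) (nonneg-lift m hs)

liftIter : MDist → ℕ → MDist
liftIter m zero = m
liftIter m (suc k) = liftStep (liftIter m k)

iterM≡liftIter : ∀ M k → iterM M k ≡ liftIter (dirac M) k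
iterM≡liftIter M zero = refl
iterM≡liftIter M (suc k) = cong liftStep (iterM≡liftIter M k)

liftIter-shift : ∀ m k → liftIter (liftStep m) k ≡ liftIter m (suc k)
liftIter-shift m zero = refl
liftIter-shift m (suc k) = cong liftStep (liftIter-shift m k)

mass-liftIter : ∀ m k → mass (liftIter m k) ≡ mass m
mass-liftIter m zero = refl
mass-liftIter m (suc k) = trans (mass-lift (liftIter m k)) (mass-liftIter m k)

nonneg-liftIter : ∀ m k → NonNeg m → NonNeg (liftIter m k)
nonneg-liftIter m zero h = h
nonneg-liftIter m (suc k) h = nonneg-lift (liftIter m k) (nonneg-liftIter m k h)

mass-iterM : ∀ M j → mass (iterM M j) ≡ 1ℚ
mass-iterM M j = trans (cong mass (iterM≡liftIter M j)) (mass-liftIter (dirac M) j)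

nonneg-iterM : ∀ M j → NonNeg (iterM M j)
nonneg-iterM M j = subst NonNeg (sym (iterM≡liftIter M j)) (nonneg-liftIter (dirac M) j (0≤1 ∷ []))

nonValueMass-iterM : ∀ M j → nonValueMass (iterM M j) ≡ 1ℚ - Pk M j
nonValueMass-iterM M j = trans (solve 2 (λ v n → n := (v :+ n) :- v) refl (valueMass (iterM M j)) (nonValueMass (iterM M j)))
  (cong (_- Pk M j) (trans (sym (mass≡value+nonValue (iterM M j))) (mass-iterM M j)))

nonValueMassSum : MDist → ℕ → ℚ
nonValueMassSum m zero = 0ℚ
nonValueMassSum m (suc k) = nonValueMass m + nonValueMassSum (liftStep m) k

nonValueMassSum-suc : ∀ m k → nonValueMassSum m (suc k) ≡ nonValueMassSum m k + nonValueMass (liftIter m k)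
nonValueMassSum-suc m zero = solve 1 (λ n → n :+ con 0ℚ := con 0ℚ :+ n) refl (nonValueMass m)
nonValueMassSum-suc m (suc k) = trans (cong (nonValueMass m +_) (nonValueMassSum-suc (liftStep m) k))
  (trans (sym (+-assoc (nonValueMass m) (nonValueMassSum (liftStep m) k) _))
    (cong (nonValueMassSum m (suc k) +_) (cong nonValueMass (liftIter-shift m k))))

Ek≡nonValueMassSum : ∀ M k → Ek M k ≡ nonValueMassSum (dirac M) k
Ek≡nonValueMassSum M zero = refl
Ek≡nonValueMassSum M (suc k) = trans (cong₂ _+_ (Ek≡nonValueMassSum M k) (trans (sym (nonValueMass-iterM M k)) (cong nonValueMass (iterM≡liftIter M k)))) (sym (nonValueMassSum-suc (dirac M) k))

data Typing : MDist → Set where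
  tnil : Typing []
  tcons : ∀ {p N w a m} {Γ : Ctx 0} → DerT Γ w N a → Typing m → Typing ((p , N) ∷ m)

weightSum : ∀ {m} → Typing m → ℚ
weightSum tnil = 0ℚ
weightSum (tcons {p = p} {w = w} D tl) = p * w + weightSum tl

typeSum : ∀ {m} → Typing m → TDist
typeSum tnil = []
typeSum (tcons {p = p} {a = a} D tl) = scaleD p a ++ typeSum tl

AllSizes< : ℕ → ∀ {m} → Typing m → Set
AllSizes< K tnil = ⊤
AllSizes< K (tcons D tl) = (sizeT D N.< K) × AllSizes< K tl

AllTight : ∀ {m} → Typing m → Set
AllTight tnil = ⊤
AllTight (tcons {a = a} D tl) = Tight a × AllTight tl

typing-++ : ∀ {L1 L2} → Typing L1 → Typing L2 → Typing (L1 ++ L2)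
typing-++ tnil t2 = t2
typing-++ (tcons D t1) t2 = tcons D (typing-++ t1 t2)

weightSum-++ : ∀ {L1 L2} (t1 : Typing L1) (t2 : Typing L2) →
  weightSum (typing-++ t1 t2) ≡ weightSum t1 + weightSum t2
weightSum-++ tnil t2 = sym (+-identityˡ _)
weightSum-++ (tcons {p = p} {w = w} D t1) t2 = trans (cong (p * w +_) (weightSum-++ t1 t2))
  (sym (+-assoc (p * w) (weightSum t1) (weightSum t2)))

typeSum-++ : ∀ {L1 L2} (t1 : Typing L1) (t2 : Typing L2) → typeSum (typing-++ t1 t2) ≡ typeSum t1 ++ typeSum t2
typeSum-++ tnil t2 = refl
typeSum-++ (tcons {p = p} {a = a} D t1) t2 = trans (cong (scaleD p a ++_) (typeSum-++ t1 t2))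
  (sym (++-assoc (scaleD p a) (typeSum t1) (typeSum t2)))

allTight-++ : ∀ {L1 L2} (t1 : Typing L1) (t2 : Typing L2) → AllTight t1 → AllTight t2 → AllTight (typing-++ t1 t2)
allTight-++ tnil t2 _ h = h
allTight-++ (tcons D t1) t2 (h1 , hs) h = h1 , allTight-++ t1 t2 hs h

allTight-++⁻ : ∀ {L1 L2} (t1 : Typing L1) (t2 : Typing L2) → AllTight (typing-++ t1 t2) → AllTight t1 × AllTight t2
allTight-++⁻ tnil t2 h = tt , h
allTight-++⁻ (tcons D t1) t2 (h , hs) with allTight-++⁻ t1 t2 hs
... | a , b = (h , a) , b

typing-split : ∀ L1 {L2} (tl : Typing (L1 ++ L2)) → Σ (Typing L1) λ t1 → Σ (Typing L2) λ t2 → tl ≡ typing-++ t1 t2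
typing-split [] tl = tnil , tl , refl
typing-split (x ∷ L1) (tcons D tl) with typing-split L1 tl
... | t1 , t2 , refl = tcons D t1 , t2 , refl

typing-scale : ∀ p {L} → Typing L → Typing (scaleM p L)
typing-scale p tnil = tnil
typing-scale p (tcons {p = q} D tl) = tcons {p = p * q} D (typing-scale p tl)

weightSum-scale : ∀ p {L} (tl : Typing L) → weightSum (typing-scale p tl) ≡ p * weightSum tl
weightSum-scale p tnil = sym (*-zeroʳ p)
weightSum-scale p (tcons {p = q} {w = w} D tl) = trans (cong (p * q * w +_) (weightSum-scale p tl))
  (solve 4 (λ p q w x → p :* q :* w :+ p :* x := p :* (q :* w :+ x)) refl p q w (weightSum tl))

typeSum-scale : ∀ p {L} (tl : Typing L) → typeSum (typing-scale p tl) ≡ scaleD p (typeSum tl)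
typeSum-scale p tnil = refl
typeSum-scale p (tcons {p = q} {a = a} D tl) = trans (cong₂ _++_ (sym (scaleD-* p q a)) (typeSum-scale p tl))
  (sym (scaleD-++ p (scaleD q a) (typeSum tl)))

allTight-scale : ∀ p {L} (tl : Typing L) → AllTight tl → AllTight (typing-scale p tl)
allTight-scale p tnil _ = tt
allTight-scale p (tcons D tl) (h , hs) = h , allTight-scale p tl hs

allTight-unscale : ∀ p {L} (t : Typing L) → AllTight (typing-scale p t) → AllTight t
allTight-unscale p tnil _ = tt
allTight-unscale p (tcons D t) (h , hs) = h , allTight-unscale p t hs

typing-unscale : ∀ p L (tl : Typing (scaleM p L)) → Σ (Typing L) λ t0 → tl ≡ typing-scale p t0
typing-unscale p [] tnil = tnil , refl
typing-unscale p ((q , N) ∷ L) (tcons D tl) with typing-unscale p L tl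
... | t0 , refl = tcons D t0 , refl

tight-scaleD⁻ : ∀ p a → Tight (scaleD p a) → Tight a
tight-scaleD⁻ p [] [] = []
tight-scaleD⁻ p (x ∷ a) (h ∷ hs) = h ∷ tight-scaleD⁻ p a hs

tight-scaleD : ∀ p a → Tight a → Tight (scaleD p a)
tight-scaleD p [] [] = []
tight-scaleD p (x ∷ a) (h ∷ hs) = h ∷ tight-scaleD p a hs

tight⇒allTight : ∀ {L} (tl : Typing L) → Tight (typeSum tl) → AllTight tl
tight⇒allTight tnil _ = tt
tight⇒allTight (tcons {p = p} {a = a} D tl) h with AllP.++⁻ (scaleD p a) h
... | h1 , h2 = tight-scaleD⁻ p a h1 , tight⇒allTight tl h2

allTight⇒tight : ∀ {L} (tl : Typing L) → AllTight tl → Tight (typeSum tl)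
allTight⇒tight tnil _ = []
allTight⇒tight (tcons {p = p} {a = a} D tl) (h , hs) = AllP.++⁺ (tight-scaleD p a h) (allTight⇒tight tl hs)

branches-split : ∀ {n} {M : Term (suc n)} a1 {a2 Δ ws b} (br : Branches M (a1 ++ a2) Δ ws b) →
  Σ (Ctx n) λ Δ1 → Σ (Ctx n) λ Δ2 → Σ ℚ λ ws1 → Σ ℚ λ ws2 → Σ TDist λ b1 → Σ TDist λ b2 →
  Σ (Branches M a1 Δ1 ws1 b1) λ br1 → Σ (Branches M a2 Δ2 ws2 b2) λ br2 →
  (ws ≡ ws1 + ws2) × (b ≡ b1 ++ b2) × (sizeBr br ≡ sizeBr br1 N.+ sizeBr br2)
branches-split [] br = _ , _ , _ , _ , _ , _ , br-nil , br , sym (+-identityˡ _) , refl , refl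
branches-split (x ∷ a1) (br-cons {p = p} {w = w} {b = b} d e br) with branches-split a1 br
... | Δ1 , Δ2 , ws1 , ws2 , b1 , b2 , br1 , br2 , refl , refl , s =
  _ , _ , _ , _ , _ , _ , br-cons d e br1 , br2 ,
  sym (+-assoc (p * w) ws1 ws2) ,
  sym (++-assoc (scaleD p b) b1 b2) ,
  trans (cong (sizeT d N.+_) s) (sym (NP.+-assoc (sizeT d) _ _))

branches-unscale : ∀ {n} {M : Term (suc n)} p a {Δ ws b} (br : Branches M (scaleD p a) Δ ws b) →
  Σ (Ctx n) λ Δ' → Σ ℚ λ ws' → Σ TDist λ b' → Σ (Branches M a Δ' ws' b') λ br' →
  (ws ≡ p * ws') × (b ≡ scaleD p b') × (sizeBr br ≡ sizeBr br')
branches-unscale p [] br-nil = _ , _ , _ , br-nil , sym (*-zeroʳ p) , refl , refl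
branches-unscale p ((pk , Mk) ∷ a) (br-cons {w = w} {b = bk} d e br) with branches-unscale p a br
... | Δ' , ws' , b' , br' , refl , refl , s =
  _ , _ , _ , br-cons {p = pk} d e br' ,
  solve 4 (λ p q w x → p :* q :* w :+ p :* x := p :* (q :* w :+ x)) refl p pk w ws' ,
  trans (cong (_++ scaleD p b') (sym (scaleD-* p pk bk))) (sym (scaleD-++ p (scaleD pk bk) b')) ,
  cong (sizeT d N.+_) s

branches-scale : ∀ {n} {M : Term (suc n)} p {a Δ ws b} (br : Branches M a Δ ws b) →
  Σ (Ctx n) λ Δ' → Σ (Branches M (scaleD p a) Δ' (p * ws) (scaleD p b)) λ _ → ⊤
branches-scale p br-nil = _ , subst (λ z → Branches _ [] ∅ z []) (sym (*-zeroʳ p)) br-nil , tt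
branches-scale p (br-cons {p = pk} {w = w} {ws = ws} {b = bk} {bs = bs} d e br) with branches-scale p br
... | Δ' , br' , _ = _ ,
  subst₂ (λ z y → Branches _ _ _ z y)
    (solve 4 (λ p q w x → p :* q :* w :+ p :* x := p :* (q :* w :+ x)) refl p pk w ws)
    (trans (cong (_++ scaleD p bs) (sym (scaleD-* p pk bk))) (sym (scaleD-++ p (scaleD pk bk) bs)))
    (br-cons {p = p * pk} d e br') , tt

branches-++ : ∀ {n} {M : Term (suc n)} {a1 a2 Δ1 Δ2 ws1 ws2 b1 b2} → Branches M a1 Δ1 ws1 b1 →
  Branches M a2 Δ2 ws2 b2 →
  Σ (Ctx n) λ Δ → Σ ℚ λ ws → Σ (Branches M (a1 ++ a2) Δ ws (b1 ++ b2)) λ _ → ws ≡ ws1 + ws2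
branches-++ br-nil br2 = _ , _ , br2 , sym (+-identityˡ _)
branches-++ {ws2 = ws2} (br-cons {p = p} {w = w} {ws = ws} {b = b} {bs = bs} d e br) br2 with branches-++ br br2
... | Δ , ws' , br' , refl = _ , _ ,
  subst (λ y → Branches _ _ _ _ y) (sym (++-assoc (scaleD p b) bs _)) (br-cons d e br') ,
  sym (+-assoc (p * w) ws ws2)

-- Subject reduction

subjectReduction-β : ∀ (B : Term 1) W {G1 : Ctx 0} {Mx wb b} (Db : DerT (Mx ∷v G1) wb B b) {Δ : Ctx 0} {v M'}
  (bw : Bang Δ v W M') (eq : M' ≈I Mx) →
  Σ ℚ λ w' → Σ TDist λ a' → Σ (DerT []v w' (B [ W /0]) a') λ D' →
    (w' ≡ wb + v) × (a' ≈D b) × (sizeT D' N.≤ sizeT Db N.+ sizeB bw)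
subjectReduction-β B W {G1} {Mx} {wb} Db bw (inter≈ p) with PermA.toNF p
... | zs , pr , pw with closedBang-↭ bw pr
... | v' , bz , refl , es
  with substitutionT W (substLast-top {σ = topSubst W} refl) (castCtxT (cong (Mx ∷v_) (ctx0-[] G1)) Db) {c = 1ℚ} bz
         (subst (Pointwise _≈qA_ zs) (sym (scaleI-identity Mx)) pw)
... | resT Γ' w' a' D' ce ae u cu wu sz =
  w' , a' , castCtxT (ctx0-[] Γ') (castTermT (subT-topSubst B W) D') ,
  trans wu (cong (wb +_) (trans (sym (*-identityˡ u)) cu)) , ae ,
  NP.≤-trans (NP.≤-reflexive (trans (castCtxT-size (ctx0-[] Γ') _) (castTermT-size (subT-topSubst B W) D')))
    (NP.≤-trans sz (NP.≤-reflexive (cong₂ N._+_ (castCtxT-size (cong (Mx ∷v_) (ctx0-[] G1)) Db) (sym es))))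

size-β-app : ∀ a b → a N.+ b N.≤ (suc a N.+ 0) N.+ b
size-β-app a b = NP.+-monoˡ-≤ b (NP.≤-trans (NP.n≤1+n a) (NP.≤-reflexive (sym (NP.+-identityʳ (suc a)))))

size-β-let : ∀ a b → a N.+ b N.≤ suc b N.+ (a N.+ 0)
size-β-let a b = NP.≤-trans (NP.≤-reflexive (NP.+-comm a b))
  (NP.≤-trans (NP.n≤1+n (b N.+ a)) (NP.≤-reflexive (cong (λ z → suc b N.+ z) (sym (NP.+-identityʳ a)))))

zeroTyping-< : ∀ (L : MDist) K → Σ (Typing L) λ tl → (weightSum tl ≡ 0ℚ) × (typeSum tl ≡ []) × AllSizes< (suc K) tl
zeroTyping-< [] K = tnil , refl , refl , tt
zeroTyping-< ((p , N) ∷ L) K with zeroTyping-< L K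
... | tl , e1 , e2 , al = tcons {p = p} {Γ = []v} zero-rule tl ,
  trans (cong₂ _+_ (*-zeroʳ p) e1) (+-identityˡ 0ℚ) , e2 , s≤s z≤n , al

letTyping : ∀ (M : Term 1) (L : MDist) (tl : Typing L) {Δ : Ctx 0} {ws b} (Br : Branches M (typeSum tl) Δ ws b) K S →
  AllSizes< K tl → sizeBr Br N.≤ S →
  Σ (Typing (map (inLet M) L)) λ tl' → (weightSum tl' ≡ ws + weightSum tl + mass L) ×
    (typeSum tl' ≡ b) × AllSizes< (suc (K N.+ S)) tl'
letTyping M [] tnil br-nil K S _ _ = tnil , refl , refl , tt
letTyping M ((p , N') ∷ L) (tcons {w = w} {a = a} D tl) Br K S (lt , al) sb
  with branches-split (scaleD p a) Br
... | Δ1 , Δ2 , ws1 , ws2 , b1 , b2 , br1 , br2 , refl , refl , s with branches-unscale p a br1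
... | Δ1' , ws1' , b1' , br1' , refl , refl , s1 with letTyping M L tl br2 K S al
       (NP.≤-trans (NP.m≤n+m (sizeBr br2) (sizeBr br1)) (NP.≤-trans (NP.≤-reflexive (sym s)) sb))
... | tl' , we , te , al' =
  tcons {p = p} (let-rule D br1') tl' ,
  trans (cong (p * ((ws1' + w) + 1ℚ) +_) we)
    (solve 6 (λ p x w y z m → p :* ((x :+ w) :+ con 1ℚ) :+ ((y :+ z) :+ m) := (p :* x :+ y) :+ (p :* w :+ z) :+ (p :+ m)) refl p ws1' w ws2 (weightSum tl) (mass L)) ,
  cong (scaleD p b1' ++_) te ,
  s≤s (NP.+-mono-≤ lt (NP.≤-trans (NP.≤-reflexive (sym s1)) (NP.≤-trans (NP.m≤m+n (sizeBr br1) (sizeBr br2)) (NP.≤-trans (NP.≤-reflexive (sym s)) sb)))) ,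
  al'

mutual
  subjectReduction : ∀ (N : Term 0) {Γ : Ctx 0} {w a k} (D : DerT Γ w N a) → isValue N ≡ false → sizeT D ≡ suc k →
    Σ (Typing (stepT N)) λ tl → (weightSum tl + 1ℚ ≡ w) × (typeSum tl ≈D a) × AllSizes< (suc k) tl
  subjectReduction (app (lam B) W) (app-rule (!-rule (bang-cons iu (λ-rule {w = wb} Db) bang-nil)) dw eq) _ refl
    with subjectReduction-β B W Db (closedDerI⇒bang dw) eq
  ... | w' , a' , D' , refl , ae , sz =
    tcons {p = 1ℚ} D' tnil ,
    solve 2 (λ x y → con 1ℚ :* (x :+ y) :+ con 0ℚ :+ con 1ℚ := (con 1ℚ :* (x :+ con 1ℚ) :+ con 0ℚ) :+ y) refl wb _ ,
    ≈D-trans (≈D-reflexive (trans (++-identityʳ _) (scaleD-identity a'))) ae ,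
    s≤s (NP.≤-trans sz (NP.≤-trans (NP.≤-reflexive (cong (sizeT Db N.+_) (closedDerI⇒bang-size dw))) (size-β-app (sizeT Db) _))) , tt
  subjectReduction (M ⊕ N) (⊕-rule {w = w1} {v = w2} {a = a} {b = b} d1 d2) _ refl =
    tcons {p = ½} d1 (tcons {p = ½} d2 tnil) ,
    solve 2 (λ x y → con ½ :* x :+ (con ½ :* y :+ con 0ℚ) :+ con 1ℚ := con ½ :* x :+ con ½ :* y :+ con 1ℚ) refl w1 w2 ,
    ≈D-reflexive (cong (scaleD ½ a ++_) (++-identityʳ _)) ,
    (s≤s (NP.m≤m+n _ _) , s≤s (NP.m≤n+m _ _) , tt)
  subjectReduction (let' (val V) M) (let-rule zero-rule br-nil) _ refl =
    tcons {p = 1ℚ} {Γ = []v} zero-rule tnil , refl , ≈D-refl [] , s≤s z≤n , tt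
  subjectReduction (let' (val V) M) (let-rule {v = v} (val-rule DI) (br-cons {w = w} {b = b} Db e br-nil)) _ refl
    with subjectReduction-β M V Db (closedDerI⇒bang DI) (≈I-sym e)
  ... | w' , a' , D' , refl , ae , sz =
    tcons {p = 1ℚ} D' tnil ,
    solve 2 (λ x y → con 1ℚ :* (x :+ y) :+ con 0ℚ :+ con 1ℚ := (con 1ℚ :* x :+ con 0ℚ :+ y) :+ con 1ℚ) refl w v ,
    ≈D-++ (≈D-scale 1ℚ ae) (≈D-refl []) ,
    s≤s (NP.≤-trans sz (NP.≤-trans (NP.≤-reflexive (cong (sizeT Db N.+_) (closedDerI⇒bang-size DI))) (size-β-let (sizeT Db) (sizeI DI)))) , tt
  subjectReduction (let' (app V W) M) (let-rule dn br) _ refl = subjectReduction-let (app V W) refl M dn br refl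
  subjectReduction (let' (N ⊕ N') M) (let-rule dn br) _ refl = subjectReduction-let (N ⊕ N') refl M dn br refl
  subjectReduction (let' (let' N K) M) (let-rule dn br) _ refl = subjectReduction-let (let' N K) refl M dn br refl

  subjectReduction-let : ∀ (N : Term 0) → isValue N ≡ false → ∀ (M : Term 1) {Γ Δ : Ctx 0} {v ws a b k}
    (dn : DerT Γ v N a) (br : Branches M a Δ ws b) → sizeT dn N.+ sizeBr br ≡ k →
    Σ (Typing (map (inLet M) (stepT N))) λ tl → (weightSum tl + 1ℚ ≡ (ws + v) + 1ℚ) ×
      (typeSum tl ≈D b) × AllSizes< (suc k) tl
  subjectReduction-let N nv M {k = k} zero-rule br-nil refl with zeroTyping-< (map (inLet M) (stepT N)) k
  ... | tl , e1 , e2 , al = tl , cong (_+ 1ℚ) e1 , ≈D-reflexive e2 , al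
  subjectReduction-let N nv M dn@(app-rule _ _ _) br e = subjectReduction-let′ N nv M dn br refl e
  subjectReduction-let N nv M dn@(⊕-rule _ _) br e = subjectReduction-let′ N nv M dn br refl e
  subjectReduction-let N nv M dn@(let-rule _ _) br e = subjectReduction-let′ N nv M dn br refl e
  subjectReduction-let N nv M dn@(val-rule _) br e = subjectReduction-let′ N nv M dn br refl e

  subjectReduction-let′ : ∀ (N : Term 0) → isValue N ≡ false → ∀ (M : Term 1) {Γ Δ : Ctx 0} {v ws a b k j}
    (dn : DerT Γ v N a) (br : Branches M a Δ ws b) → sizeT dn ≡ suc j → sizeT dn N.+ sizeBr br ≡ k →
    Σ (Typing (map (inLet M) (stepT N))) λ tl → (weightSum tl + 1ℚ ≡ (ws + v) + 1ℚ) ×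
      (typeSum tl ≈D b) × AllSizes< (suc k) tl
  subjectReduction-let′ N nv M {ws = ws} dn br ej refl with subjectReduction N dn nv ej
  ... | tl , wq , te , al with branches-≈D br te
  ... | Δ' , ws' , b' , Br' , ce , refl , be , s' with letTyping M (stepT N) tl Br' (sizeT dn) (sizeBr br)
         (subst (λ z → AllSizes< z tl) (sym ej) al) (NP.≤-reflexive s')
  ... | tl' , we , te' , al' =
    tl' ,
    trans (cong (_+ 1ℚ) (trans we (cong (ws' + weightSum tl +_) (mass-stepT N))))
      (trans (solve 2 (λ x y → x :+ y :+ con 1ℚ :+ con 1ℚ := x :+ (y :+ con 1ℚ) :+ con 1ℚ) refl ws' (weightSum tl))
             (cong (λ z → ws' + z + 1ℚ) wq)) ,
    ≈D-trans (≈D-reflexive te') be , al'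

-- Subject expansion

-- Only ≤: an entry typed by the zero rule adds its probability to mass L but no weight.
letTyping-inv : ∀ (M : Term 1) (L : MDist) → NonNeg L → (tl : Typing (map (inLet M) L)) →
  Σ (Typing L) λ tlN → Σ (Ctx 0) λ Δ → Σ ℚ λ ws → Σ TDist λ b → Σ (Branches M (typeSum tlN) Δ ws b) λ _ →
    (weightSum tl ≤ ws + weightSum tlN + mass L) × (b ≡ typeSum tl)
letTyping-inv M [] [] tnil = tnil , ∅ , 0ℚ , [] , br-nil , ≤-refl , refl
letTyping-inv M ((p , N') ∷ L) (h ∷ hs) (tcons zero-rule tl) with letTyping-inv M L hs tl
... | tlN , Δ , ws , b , Br , ineq , te =
  tcons {p = p} {Γ = []v} zero-rule tlN , Δ , ws , b , Br ,
  ≤-trans (≤-reflexive (trans (cong (_+ weightSum tl) (*-zeroʳ p)) (+-identityˡ _)))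
    (≤-trans ineq (≤-trans (+-monoʳ-≤ (ws + weightSum tlN) (≤-trans (≤-reflexive (sym (+-identityˡ (mass L)))) (+-monoˡ-≤ (mass L) h)))
      (≤-reflexive (solve 4 (λ x y p m → x :+ y :+ (p :+ m) := x :+ (p :* con 0ℚ :+ y) :+ (p :+ m)) refl ws (weightSum tlN) p (mass L))))) ,
  te
letTyping-inv M ((p , N') ∷ L) (h ∷ hs) (tcons (let-rule {v = v} {ws = wsb} dn br) tl) with letTyping-inv M L hs tl
... | tlN , Δ , ws , b , Br , ineq , te with branches-scale p br
... | Δs , brs , _ with branches-++ brs Br
... | Δa , wsa , bra , refl =
  tcons {p = p} dn tlN , _ , _ , _ , bra ,
  ≤-trans (+-monoʳ-≤ (p * ((wsb + v) + 1ℚ)) ineq)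
    (≤-reflexive (solve 7 (λ p a v x y m n → p :* ((a :+ v) :+ con 1ℚ) :+ (x :+ y :+ m) := (p :* a :+ x) :+ (p :* v :+ y) :+ (p :+ m)) refl p wsb v ws (weightSum tlN) (mass L) (mass L))) ,
  cong (scaleD p _ ++_) te

mutual
  subjectExpansion : ∀ (N : Term 0) → isValue N ≡ false → (tl : Typing (stepT N)) →
    Σ ℚ λ w → Σ TDist λ a → Σ (Ctx 0) λ Γ → Σ (DerT Γ w N a) λ _ → (weightSum tl + 1ℚ ≤ w) × (a ≡ typeSum tl)
  subjectExpansion (app (lam B) W) _ (tcons {w = w'} {a = a'} D' tnil)
    with antiSubstitutionT W (substLast-top {σ = topSubst W} refl) B (castTermT (sym (subT-topSubst B W)) D')
  ... | antiResT (x ∷v []v) w1 w2 .x bg DB ie refl refl =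
    _ , _ , _ , app-rule (!-rule (bang-cons {Γ = []v} {Δ = []v} InUnit-1 (λ-rule DB) bang-nil)) (!-rule bg)
      (≈I-refl x) ,
    ≤-reflexive (solve 2 (λ a b → con 1ℚ :* (a :+ b) :+ con 0ℚ :+ con 1ℚ := con 1ℚ :* (a :+ con 1ℚ) :+ con 0ℚ :+ b) refl w1 w2) ,
    sym (trans (++-identityʳ _) (scaleD-identity a'))
  subjectExpansion (M ⊕ N) _ (tcons {w = w1} {a = a1} d1 (tcons {w = w2} {a = a2} d2 tnil)) =
    _ , _ , _ , ⊕-rule d1 d2 ,
    ≤-reflexive (solve 2 (λ x y → con ½ :* x :+ (con ½ :* y :+ con 0ℚ) :+ con 1ℚ := con ½ :* x :+ con ½ :* y :+ con 1ℚ) refl w1 w2) ,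
    cong (scaleD ½ a1 ++_) (sym (++-identityʳ _))
  subjectExpansion (let' (val V) M) _ (tcons {w = w'} {a = a'} D' tnil)
    with antiSubstitutionT V (substLast-top {σ = topSubst V} refl) M (castTermT (sym (subT-topSubst M V)) D')
  ... | antiResT (x ∷v []v) w1 w2 .x bg DB ie refl refl =
    _ , _ , _ , let-rule (val-rule (!-rule bg)) (br-cons {p = 1ℚ} {Δ = []v} DB (≈I-refl x) br-nil) ,
    ≤-reflexive (solve 2 (λ a b → con 1ℚ :* (a :+ b) :+ con 0ℚ :+ con 1ℚ := (con 1ℚ :* a :+ con 0ℚ :+ b) :+ con 1ℚ) refl w1 w2) ,
    refl
  subjectExpansion (let' (app V W) M) _ tl = subjectExpansion-let (app V W) refl M tl
  subjectExpansion (let' (N ⊕ N') M) _ tl = subjectExpansion-let (N ⊕ N') refl M tl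
  subjectExpansion (let' (let' N K) M) _ tl = subjectExpansion-let (let' N K) refl M tl

  subjectExpansion-let : ∀ (N : Term 0) → isValue N ≡ false →
    ∀ (M : Term 1) (tl : Typing (map (inLet M) (stepT N))) →
    Σ ℚ λ w → Σ TDist λ a → Σ (Ctx 0) λ Γ → Σ (DerT Γ w (let' N M) a) λ _ → (weightSum tl + 1ℚ ≤ w) × (a ≡ typeSum tl)
  subjectExpansion-let N nv M tl with letTyping-inv M (stepT N) (stepT-nonneg N) tl
  ... | tlN , Δ , ws , b , Br , ineq , te with subjectExpansion N nv tlN
  ... | vN , aN , ΓN , DN , ineqN , refl =
    _ , _ , _ , let-rule DN Br ,
    ≤-trans (+-monoˡ-≤ 1ℚ (≤-trans ineq (≤-reflexive (cong (ws + weightSum tlN +_) (mass-stepT N)))))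
      (≤-trans (≤-reflexive (solve 2 (λ x y → x :+ y :+ con 1ℚ :+ con 1ℚ := x :+ (y :+ con 1ℚ) :+ con 1ℚ) refl ws (weightSum tlN)))
        (+-monoˡ-≤ 1ℚ (+-monoʳ-≤ ws ineqN))) ,
    te

-- Soundness

SizeBound : Bool → ℕ → ℕ → Set
SizeBound true s K = ⊤
SizeBound false s K = s N.≤ K

AllSizeBound : ℕ → ∀ {m} → Typing m → Set
AllSizeBound K tnil = ⊤
AllSizeBound K (tcons {N = N} D tl) = SizeBound (isValue N) (sizeT D) K × AllSizeBound K tl

-- An entry is active when it is not a value and its derivation is not the
-- zero rule; a lifted step lowers the total weight by exactly the active mass.
activeMassEntry : Bool → ℕ → ℚ → ℚ
activeMassEntry true _ _ = 0ℚ
activeMassEntry false zero _ = 0ℚ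
activeMassEntry false (suc _) p = p

activeMass : ∀ {m} → Typing m → ℚ
activeMass tnil = 0ℚ
activeMass (tcons {p = p} {N = N} D tl) = activeMassEntry (isValue N) (sizeT D) p + activeMass tl

sizeBound-0 : ∀ b K → SizeBound b 0 K
sizeBound-0 true K = tt
sizeBound-0 false K = z≤n

sizeBound-refl : ∀ b s → SizeBound b s s
sizeBound-refl true s = tt
sizeBound-refl false s = NP.≤-refl

size≡0⇒empty : ∀ {Γ : Ctx 0} {w N a} (D : DerT Γ w N a) → sizeT D ≡ 0 → (w ≡ 0ℚ) × (a ≡ [])
size≡0⇒empty zero-rule _ = refl , refl

allSizeBound-++ : ∀ {K L1 L2} (t1 : Typing L1) (t2 : Typing L2) → AllSizeBound K t1 → AllSizeBound K t2 →
  AllSizeBound K (typing-++ t1 t2)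
allSizeBound-++ tnil t2 _ h = h
allSizeBound-++ (tcons D t1) t2 (h1 , hs) h = h1 , allSizeBound-++ t1 t2 hs h

allSizes<⇒allSizeBound : ∀ {k K L} p (tl : Typing L) → AllSizes< (suc k) tl → k N.≤ K →
  AllSizeBound K (typing-scale p tl)
allSizes<⇒allSizeBound p tnil _ _ = tt
allSizes<⇒allSizeBound {K = K} p (tcons {N = N} D tl) (lt , al) kK = g (isValue N) , allSizes<⇒allSizeBound p tl al kK
  where
  g : ∀ b → SizeBound b (sizeT D) K
  g true = tt
  g false = NP.≤-trans (NP.≤-pred lt) kK

zeroTyping-tight : ∀ L K → Σ (Typing L) λ t → AllTight t × AllSizeBound K t × (weightSum t ≡ 0ℚ) × (typeSum t ≡ [])
zeroTyping-tight [] K = tnil , tt , tt , refl , refl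
zeroTyping-tight ((p , N) ∷ L) K with zeroTyping-tight L K
... | t , ti , an , we , te = tcons {p = p} {Γ = []v} zero-rule t , ([] , ti) , (sizeBound-0 (isValue N) K , an) ,
  trans (cong₂ _+_ (*-zeroʳ p) we) (+-identityˡ 0ℚ) , te

typing-step-nonValue : ∀ p (N : Term 0) → isValue N ≡ false → ∀ {Γ : Ctx 0} {w a} K (D : DerT Γ w N a) →
  Tight a → sizeT D N.≤ K →
  Σ (Typing (scaleM p (stepT N))) λ t → AllTight t × AllSizeBound (K ∸ 1) t ×
    (weightSum t + activeMassEntry false (sizeT D) p ≡ p * w) × (norm (typeSum t) ≡ p * norm a)
typing-step-nonValue p N nv K D h le with sizeT D in eq
... | zero with size≡0⇒empty D eq
... | refl , refl with zeroTyping-tight (scaleM p (stepT N)) (K ∸ 1)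
... | t , ti , an , we , te = t , ti , an ,
  trans (cong (_+ 0ℚ) we) (sym (*-zeroʳ p)) , trans (cong norm te) (sym (*-zeroʳ p))
typing-step-nonValue p N nv {w = w} {a = a} K D h le | suc k with subjectReduction N D nv eq
... | tlN , wq , te , al =
  typing-scale p tlN , allTight-scale p tlN (tight⇒allTight tlN (tight-≈D te h)) ,
  allSizes<⇒allSizeBound p tlN al (NP.∸-monoˡ-≤ 1 le) ,
  trans (cong (_+ p) (weightSum-scale p tlN)) (trans (solve 2 (λ p x → p :* x :+ p := p :* (x :+ con 1ℚ)) refl p (weightSum tlN)) (cong (p *_) wq)) ,
  trans (cong norm (typeSum-scale p tlN)) (trans (norm-scale p (typeSum tlN)) (cong (p *_) (norm-≈D te)))

typing-step-entry : ∀ p (N : Term 0) {Γ : Ctx 0} {w a} K (D : DerT Γ w N a) → Tight a →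
  SizeBound (isValue N) (sizeT D) K →
  Σ (Typing (scaleM p (stepT N))) λ t → AllTight t × AllSizeBound (K ∸ 1) t ×
    (weightSum t + activeMassEntry (isValue N) (sizeT D) p ≡ p * w) × (norm (typeSum t) ≡ p * norm a)
typing-step-entry p (val V) {w = w} {a = a} K D h _ =
  tcons {p = p * 1ℚ} D tnil , (h , tt) , (tt , tt) ,
  solve 2 (λ p w → p :* con 1ℚ :* w :+ con 0ℚ :+ con 0ℚ := p :* w) refl p w ,
  trans (norm-scaleD-++ (p * 1ℚ) a []) (solve 2 (λ p n → p :* con 1ℚ :* n :+ con 0ℚ := p :* n) refl p (norm a))
typing-step-entry p (app V W) K D h le = typing-step-nonValue p (app V W) refl K D h le
typing-step-entry p (M ⊕ N) K D h le = typing-step-nonValue p (M ⊕ N) refl K D h le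
typing-step-entry p (let' N M) K D h le = typing-step-nonValue p (let' N M) refl K D h le

typing-step : ∀ m (tl : Typing m) K → AllTight tl → AllSizeBound K tl →
  Σ (Typing (liftStep m)) λ tl' → AllTight tl' × AllSizeBound (K ∸ 1) tl' ×
    (weightSum tl' + activeMass tl ≡ weightSum tl) × (norm (typeSum tl') ≡ norm (typeSum tl))
typing-step [] tnil K _ _ = tnil , tt , tt , refl , refl
typing-step ((p , N) ∷ m) (tcons {w = w} {a = a} D tl) K (h , hs) (n , ns)
  with typing-step-entry p N K D h n | typing-step m tl K hs ns
... | t , ti , an , we , ne | t' , ti' , an' , we' , ne' =
  typing-++ t t' , allTight-++ t t' ti ti' , allSizeBound-++ t t' an an' ,
  trans (cong (_+ (activeMassEntry (isValue N) (sizeT D) p + activeMass tl)) (weightSum-++ t t'))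
    (trans (solve 4 (λ a b c d → (a :+ b) :+ (c :+ d) := (a :+ c) :+ (b :+ d)) refl (weightSum t) (weightSum t') (activeMassEntry (isValue N) (sizeT D) p) (activeMass tl))
      (cong₂ _+_ we we')) ,
  trans (cong norm (typeSum-++ t t')) (trans (norm-++ (typeSum t) (typeSum t'))
    (trans (cong₂ _+_ ne ne') (sym (norm-scaleD-++ p a (typeSum tl)))))

activeMassEntry≤ : ∀ b s p → 0ℚ ≤ p → activeMassEntry b s p ≤ (if b then 0ℚ else p)
activeMassEntry≤ true s p h = ≤-refl
activeMassEntry≤ false zero p h = h
activeMassEntry≤ false (suc s) p h = ≤-refl

activeMass≤nonValueMass : ∀ m (tl : Typing m) → NonNeg m → activeMass tl ≤ nonValueMass m
activeMass≤nonValueMass [] tnil [] = ≤-refl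
activeMass≤nonValueMass ((p , N) ∷ m) (tcons D tl) (h ∷ hs) = +-mono-≤
  (activeMassEntry≤ (isValue N) (sizeT D) p h) (activeMass≤nonValueMass m tl hs)

value-tight : ∀ {Γ : Ctx 0} {w V a} (D : DerT Γ w (val V) a) → Tight a → (w ≡ 0ℚ) × (norm a ≤ 1ℚ)
value-tight zero-rule _ = refl , 0≤1
value-tight (val-rule (!-rule bang-nil)) _ = refl , ≤-reflexive (+-identityʳ 1ℚ)
value-tight (val-rule (!-rule (bang-cons _ _ _))) (() ∷ _)
value-tight (val-rule (var-rule {x = ()} _)) _

size≤0⇒empty-entry : ∀ {p} {Γ : Ctx 0} {w N a} (D : DerT Γ w N a) → sizeT D N.≤ 0 → (w ≡ 0ℚ) × (p * norm a ≤ 0ℚ)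
size≤0⇒empty-entry {p} D le with size≡0⇒empty D (NP.n≤0⇒n≡0 le)
... | refl , refl = refl , ≤-reflexive (*-zeroʳ p)

exhaustedEntry : ∀ {p} (N : Term 0) {Γ : Ctx 0} {w a} (D : DerT Γ w N a) → 0ℚ ≤ p → Tight a →
  SizeBound (isValue N) (sizeT D) 0 → (w ≡ 0ℚ) × (p * norm a ≤ (if isValue N then p else 0ℚ))
exhaustedEntry {p} (val V) D 0≤p tight _ with value-tight D tight
... | refl , ‖a‖≤1 = refl , ≤-trans (*-monoˡ-≤-nonneg 0≤p ‖a‖≤1) (≤-reflexive (*-identityʳ p))
exhaustedEntry {p} (app _ _) D _ _ bound = size≤0⇒empty-entry {p} D bound
exhaustedEntry {p} (_ ⊕ _) D _ _ bound = size≤0⇒empty-entry {p} D bound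
exhaustedEntry {p} (let' _ _) D _ _ bound = size≤0⇒empty-entry {p} D bound

typing-exhausted : ∀ m (tl : Typing m) → AllTight tl → AllSizeBound 0 tl → NonNeg m →
  (weightSum tl ≡ 0ℚ) × (norm (typeSum tl) ≤ valueMass m)
typing-exhausted [] tnil _ _ _ = refl , ≤-refl
typing-exhausted ((p , N) ∷ m) (tcons {a = a} D tl) (t , ts) (s , ss) (0≤p ∷ hs)
  with exhaustedEntry N D 0≤p t s | typing-exhausted m tl ts ss hs
... | refl , pa≤ | w≡0 , ‖tl‖≤ =
  trans (cong (_+ weightSum tl) (*-zeroʳ p)) (trans (+-identityˡ _) w≡0) ,
  ≤-trans (≤-reflexive (norm-scaleD-++ p a (typeSum tl))) (+-mono-≤ pa≤ ‖tl‖≤)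

typing-iterM : ∀ M {Γ : Ctx 0} {w a} (D : DerT Γ w M a) → Tight a → ∀ j →
  Σ (Typing (iterM M j)) λ tl → AllTight tl × AllSizeBound (sizeT D ∸ j) tl ×
    Σ ℚ λ S → (w ≡ weightSum tl + S) × (S ≤ Ek M j) × (norm (typeSum tl) ≡ norm a)
typing-iterM M {w = w} {a = a} D h zero =
  tcons {p = 1ℚ} D tnil , (h , tt) , (sizeBound-refl (isValue M) (sizeT D) , tt) , 0ℚ ,
  solve 1 (λ w → w := con 1ℚ :* w :+ con 0ℚ :+ con 0ℚ) refl w , ≤-refl ,
  trans (norm-scaleD-++ 1ℚ a []) (solve 1 (λ n → con 1ℚ :* n :+ con 0ℚ := n) refl (norm a))
typing-iterM M {w = w} {a = a} D h (suc j) with typing-iterM M D h j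
... | tl , ti , an , S , we , hS , ne with typing-step (iterM M j) tl (sizeT D ∸ j) ti an
... | tl' , ti' , an' , we' , ne' =
  tl' , ti' , subst (λ z → AllSizeBound z tl') (trans (NP.∸-+-assoc (sizeT D) j 1) (cong (sizeT D ∸_) (NP.+-comm j 1))) an' ,
  S + activeMass tl ,
  trans we (trans (cong (_+ S) (sym we')) (solve 3 (λ a b c → a :+ b :+ c := a :+ (c :+ b)) refl (weightSum tl') (activeMass tl) S)) ,
  +-mono-≤ hS (≤-trans (activeMass≤nonValueMass (iterM M j) tl (nonneg-iterM M j)) (≤-reflexive (nonValueMass-iterM M j))) ,
  trans ne' ne

soundness : ∀ M {Γ : Ctx 0} {w a} (D : DerT Γ w M a) → Tight a → Σ ℕ λ K → (w ≤ Ek M K) × (norm a ≤ Pk M K)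
soundness M {w = w} {a = a} D h with typing-iterM M D h (sizeT D)
... | tl , ti , an , S , we , hS , ne with typing-exhausted (iterM M (sizeT D)) tl ti (subst (λ z → AllSizeBound z tl) (NP.n∸n≡0 (sizeT D)) an) (nonneg-iterM M (sizeT D))
... | w0 , nl = sizeT D ,
  ≤-trans (≤-reflexive (trans we (trans (cong (_+ S) w0) (+-identityˡ S)))) hS ,
  ≤-trans (≤-reflexive (sym ne)) nl

-- Completeness

valueDerivation : ∀ (N : Term 0) → Σ TDist λ a → DerT ∅ 0ℚ N a × Tight a ×
  (∀ p → p * norm a ≡ (if isValue N then p else 0ℚ))
valueDerivation (val V) = _ , val-rule (!-rule bang-nil) , refl ∷ [] ,
  λ p → solve 1 (λ p → p :* (con 1ℚ :+ con 0ℚ) := p) refl p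
valueDerivation (app _ _) = [] , zero-rule , [] , *-zeroʳ
valueDerivation (_ ⊕ _) = [] , zero-rule , [] , *-zeroʳ
valueDerivation (let' _ _) = [] , zero-rule , [] , *-zeroʳ

valueTyping : ∀ m → Σ (Typing m) λ tl → AllTight tl × (weightSum tl ≡ 0ℚ) × (norm (typeSum tl) ≡ valueMass m)
valueTyping [] = tnil , tt , refl , refl
valueTyping ((p , N) ∷ m) with valueDerivation N | valueTyping m
... | a , D , t , pa≡ | tl , ts , w≡0 , ‖tl‖≡ =
  tcons {p = p} D tl , (t , ts) , trans (cong (_+ weightSum tl) (*-zeroʳ p)) (trans (+-identityˡ _) w≡0) ,
  trans (norm-scaleD-++ p a (typeSum tl)) (cong₂ _+_ (pa≡ p) ‖tl‖≡)

expandEntry-nonValue : ∀ p (N : Term 0) → isValue N ≡ false → 0ℚ ≤ p → (t0 : Typing (stepT N)) → AllTight t0 →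
  Σ ℚ λ w → Σ TDist λ a → Σ (Ctx 0) λ Γ → Σ (DerT Γ w N a) λ _ →
    Tight a × (p * weightSum t0 + p ≤ p * w) × (norm a ≡ norm (typeSum t0))
expandEntry-nonValue p N nv hp t0 ti with subjectExpansion N nv t0
... | w , a , Γ , D , ineq , refl = w , a , Γ , D , allTight⇒tight t0 ti ,
  ≤-trans (≤-reflexive (solve 2 (λ p x → p :* x :+ p := p :* (x :+ con 1ℚ)) refl p (weightSum t0)))
    (*-monoˡ-≤-nonneg hp ineq) , refl

expandEntry : ∀ p (N : Term 0) → 0ℚ ≤ p → (t0 : Typing (stepT N)) → AllTight t0 →
  Σ ℚ λ w → Σ TDist λ a → Σ (Ctx 0) λ Γ → Σ (DerT Γ w N a) λ _ →
    Tight a × (p * weightSum t0 + (if isValue N then 0ℚ else p) ≤ p * w) × (norm a ≡ norm (typeSum t0))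
expandEntry p (val V) hp (tcons {w = w} {a = a} D tnil) (h , tt) = w , a , _ , D , h ,
  ≤-reflexive (solve 2 (λ p w → p :* (con 1ℚ :* w :+ con 0ℚ) :+ con 0ℚ := p :* w) refl p w) ,
  sym (trans (norm-scaleD-++ 1ℚ a []) (solve 1 (λ n → con 1ℚ :* n :+ con 0ℚ := n) refl (norm a)))
expandEntry p (app V W) hp t0 ti = expandEntry-nonValue p (app V W) refl hp t0 ti
expandEntry p (M ⊕ N) hp t0 ti = expandEntry-nonValue p (M ⊕ N) refl hp t0 ti
expandEntry p (let' N M) hp t0 ti = expandEntry-nonValue p (let' N M) refl hp t0 ti

typing-unstep : ∀ m → NonNeg m → (tl' : Typing (liftStep m)) → AllTight tl' →
  Σ (Typing m) λ tl → AllTight tl × (weightSum tl' + nonValueMass m ≤ weightSum tl) ×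
    (norm (typeSum tl) ≡ norm (typeSum tl'))
typing-unstep [] [] tnil _ = tnil , tt , ≤-reflexive (+-identityˡ 0ℚ) , refl
typing-unstep ((p , N) ∷ m) (hp ∷ hs) tl' ti' with typing-split (scaleM p (stepT N)) tl'
... | t1 , t2 , refl with typing-unscale p (stepT N) t1
... | t0 , refl with allTight-++⁻ (typing-scale p t0) t2 ti'
... | ti1 , ti2 with expandEntry p N hp t0 (allTight-unscale p t0 ti1) | typing-unstep m hs t2 ti2
... | w , a , Γ , D , ha , ineq , ne | tl , ti , ineq2 , ne2 =
  tcons {p = p} D tl , (ha , ti) ,
  ≤-trans (≤-reflexive (trans (cong (_+ ((if isValue N then 0ℚ else p) + nonValueMass m)) (trans (weightSum-++ (typing-scale p t0) t2) (cong (_+ weightSum t2) (weightSum-scale p t0))))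
      (solve 4 (λ a b c d → (a :+ b) :+ (c :+ d) := (a :+ c) :+ (b :+ d)) refl (p * weightSum t0) (weightSum t2) (if isValue N then 0ℚ else p) (nonValueMass m))))
    (+-mono-≤ ineq ineq2) ,
  trans (norm-scaleD-++ p a (typeSum tl)) (trans (cong₂ _+_ (cong (p *_) ne) ne2)
    (sym (trans (cong norm (typeSum-++ (typing-scale p t0) t2)) (trans (norm-++ (typeSum (typing-scale p t0)) (typeSum t2))
      (cong (_+ norm (typeSum t2)) (trans (cong norm (typeSum-scale p t0)) (norm-scale p (typeSum t0))))))))

completenessIter : ∀ k m → NonNeg m → Σ (Typing m) λ tl →
  AllTight tl × (nonValueMassSum m k ≤ weightSum tl) × (norm (typeSum tl) ≡ valueMass (liftIter m k))
completenessIter zero m h with valueTyping m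
... | tl , ti , we , ne = tl , ti , ≤-reflexive (sym we) , ne
completenessIter (suc k) m h with completenessIter k (liftStep m) (nonneg-lift m h)
... | tl' , ti' , ie' , ne' with typing-unstep m h tl' ti'
... | tl , ti , ineq , ne =
  tl , ti ,
  ≤-trans (≤-trans (+-monoʳ-≤ (nonValueMass m) ie') (≤-reflexive (solve 2 (λ a b → a :+ b := b :+ a) refl (nonValueMass m) (weightSum tl')))) ineq ,
  trans ne (trans ne' (cong valueMass (liftIter-shift m k)))

completeness : ∀ M k → Σ ℚ λ w → Σ TDist λ a → Σ (DerT ∅ w M a) λ _ → Tight a × (Ek M k ≤ w) × (norm a ≡ Pk M k)
completeness M k with completenessIter k (dirac M) (0≤1 ∷ [])
... | tcons {w = w} {a = a} D tnil , (h , tt) , ie , ne =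
  w , a , castCtxT (ctx0-[] _) D , h ,
  ≤-trans (≤-reflexive (Ek≡nonValueMassSum M k)) (≤-trans ie (≤-reflexive (solve 1 (λ w → con 1ℚ :* w :+ con 0ℚ := w) refl w))) ,
  trans (sym (trans (norm-scaleD-++ 1ℚ a []) (solve 1 (λ n → con 1ℚ :* n :+ con 0ℚ := n) refl (norm a))))
    (trans ne (cong valueMass (sym (iterM≡liftIter M k))))

Dominated : (ℚ → Set) → (ℚ → Set) → Set
Dominated S T = ∀ x → S x → ∃ λ y → T y × x ≤ y

SupIsOne-dominated : ∀ {S T} → Dominated S T → Dominated T S → SupIsOne S → SupIsOne T
SupIsOne-dominated {S} {T} S≼T T≼S (S≤1 , S-approx) = T≤1 , T-approx
  where
  T≤1 : ∀ x → T x → x ≤ 1ℚ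
  T≤1 x Tx with T≼S x Tx
  ... | y , Sy , x≤y = ≤-trans x≤y (S≤1 y Sy)
  T-approx : ∀ ε → 0ℚ < ε → ∃ λ x → T x × (1ℚ - ε) < x
  T-approx ε ε>0 with S-approx ε ε>0
  ... | x , Sx , 1-ε<x with S≼T x Sx
  ... | y , Ty , x≤y = y , Ty , <-≤-trans 1-ε<x x≤y

BoundedAbove-dominated : ∀ {S T} → Dominated S T → BoundedAbove T → BoundedAbove S
BoundedAbove-dominated S≼T (B , T≤B) = B , λ x Sx → let y , Ty , x≤y = S≼T x Sx in ≤-trans x≤y (T≤B y Ty)

module _ (M : Term 0) where

  Probabilities Expectations : ℚ → Set
  Probabilities x = ∃ λ k → x ≡ Pk M k
  Expectations x = ∃ λ k → x ≡ Ek M k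

  tightNorms≼probabilities : Dominated (TightNorms M) Probabilities
  tightNorms≼probabilities x (w , a , tight , D , refl) =
    let K , _ , ‖a‖≤Pk = soundness M D tight in Pk M K , (K , refl) , ‖a‖≤Pk

  tightWeights≼expectations : Dominated (TightWeights M) Expectations
  tightWeights≼expectations w (a , tight , D) =
    let K , w≤Ek , _ = soundness M D tight in Ek M K , (K , refl) , w≤Ek

  probabilities≼tightNorms : Dominated Probabilities (TightNorms M)
  probabilities≼tightNorms x (k , refl) =
    let w , a , D , tight , _ , ‖a‖≡Pk = completeness M k
    in norm a , (w , a , tight , D , refl) , ≤-reflexive (sym ‖a‖≡Pk)

  expectations≼tightWeights : Dominated Expectations (TightWeights M)
  expectations≼tightWeights x (k , refl) =
    let w , a , D , tight , Ek≤w , _ = completeness M k in w , (a , tight , D) , Ek≤w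

mainTheorem12 : (M : Term 0) →
  (AST M ⇔ SupIsOne (TightNorms M)) × (PAST M ⇔ BoundedAbove (TightWeights M))
mainTheorem12 M =
  mk⇔ (SupIsOne-dominated (probabilities≼tightNorms M) (tightNorms≼probabilities M))
      (SupIsOne-dominated (tightNorms≼probabilities M) (probabilities≼tightNorms M)) ,
  mk⇔ (BoundedAbove-dominated (tightWeights≼expectations M))
      (BoundedAbove-dominated (expectations≼tightWeights M))
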